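{- If $\mathcal S$ is a combinatorial sphere, then its barycentric subdivision $\operatorname{Bd}(\mathcal S)$ is also a combinatorial sphere.
   Context: A simplicial complex is a finite nonempty collection of finite sets closed under subsets (so it contains $\emptyset$); $\dim\sigma=|\sigma|-1$; $\alpha$ is a facet of $\beta$ if $\alpha\subseteq\beta$ and $\dim\alpha=\dim\beta-1$. A discrete vector field $\mathcal V$ is a set of pairs $(\alpha,\beta)$ of simplices ($\alpha=\emptyset$ allowed) with $\alpha$ a facet of $\beta$, each simplex in at most one pair. A $\mathcal V$-trajectory is a sequence $\beta_0,\alpha_1,\beta_1,\dots,\alpha_r,\beta_r$ of alternately $q$- and $(q-1)$-simplices with $(\alpha_i,\beta_i)\in\mathcal V$, $\alpha_i\subsetneq\beta_{i-1}$, $\beta_{i-1}\ne\beta_i$; it is nontrivial closed if $r>0$ and $\beta_r=\beta_0$. A gradient vector field has no nontrivial closed trajectory. A nonempty simplex is critical if it lies in no pair, or is a $0$-simplex $\sigma$ with $(\emptyset,\sigma)\in\mathcal V$. A $d$-dimensional pseudomanifold is a simplicial complex whose maximal simplices all have dimension $d$, with every $(d-1)$-simplex in exactly two $d$-simplices, and any two $d$-simplices joined by a sequence of $d$-simplices in which consecutive ones meet in a $(d-1)$-simplex. A combinatorial $d$-sphere is a $d$-dimensional pseudomanifold admitting a gradient vector field with exactly two critical simplices, one $d$-dimensional and one $0$-dimensional. The barycentric subdivision $\operatorname{Bd}(\mathcal K)$ has a vertex $v_\sigma$ for each nonempty $\sigma\in\mathcal K$, and its simplices are the sets $\{v_{\sigma_0},\dots,v_{\sigma_n}\}$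 with $\sigma_0\subsetneq\sigma_1\subsetneq\dots\subsetneq\sigma_n$ in $\mathcal K$ (together with $\emptyset$). -}

module Defs where

open import Level using (0ℓ)
open import Data.Nat using (ℕ; suc)
open import Data.Product using (Σ; ∃; _×_; _,_)
open import Data.Sum using (_⊎_)
open import Data.List using (List; []; length)
open import Data.List.Membership.Propositional using (_∈_)
open import Data.List.Relation.Binary.Subset.Propositional using (_⊆_)
open import Data.List.Relation.Unary.Linked using (Linked)
open import Data.List.Relation.Unary.All using (All)
open import Data.List.Relation.Unary.AllPairs using (AllPairs)
open import Data.List.Relation.Binary.Lex.Strict using (Lex-<)
open import Relation.Binary using (Rel)
open import Relation.Binary.PropositionalEquality using (_≡_; _≢_)
open import Relation.Binary.Construct.Closure.Transitive using (TransClosure)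
open import Relation.Binary.Construct.Closure.ReflexiveTransitive using (Star)
open import Relation.Nullary using (¬_)

-- Vertices live in a type V carrying a strict total order _<_ (w.r.t. _≡_).
-- A finite set of vertices (a simplex) is represented canonically by the
-- strictly increasing list of its elements.  Thus |σ| = length σ and
-- dim σ = length σ - 1 (so dim ∅ = -1; we always speak in terms of length).

module _ {V : Set} (_<_ : Rel V 0ℓ) where

  Simplex : Set
  Simplex = List V

  IsFacet : Simplex → Simplex → Set
  IsFacet α β = α ⊆ β × suc (length α) ≡ length β

  record IsComplex (K : Simplex → Set) : Set where
    field
      canonical  : ∀ {σ} → K σ → Linked _<_ σ
      finite     : Σ (List Simplex) λ L → ∀ {σ} → K σ → σ ∈ L
      hasEmpty   : K []
      downClosed : ∀ {α β} → K β → Linked _<_ α → α ⊆ β → K α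

  record IsDVF (K : Simplex → Set) (W : Simplex → Simplex → Set) : Set where
    field
      pairsInK   : ∀ {α β} → W α β → K α × K β × IsFacet α β
      atMostOnce : ∀ {α β α' β'} → W α β → W α' β' →
                   (α ≡ α' ⊎ α ≡ β' ⊎ β ≡ α' ⊎ β ≡ β') → α ≡ α' × β ≡ β'

  TrajStep : (W : Simplex → Simplex → Set) → Simplex → Simplex → Set
  TrajStep W β β' =
    length β ≡ length β' × β ≢ β' ×
    ∃ λ α → W α β' × α ⊆ β × ¬ (β ⊆ α)

  IsGradient : (W : Simplex → Simplex → Set) → Set
  IsGradient W = ∀ β → ¬ TransClosure (TrajStep W) β β

  Critical : (K : Simplex → Set) (W : Simplex → Simplex → Set) → Simplex → Set
  Critical K W σ =
    K σ × σ ≢ [] ×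
    ((∀ α β → W α β → σ ≢ α × σ ≢ β) ⊎ (length σ ≡ 1 × W [] σ))

  Maximal : (K : Simplex → Set) → Simplex → Set
  Maximal K σ = ∀ τ → K τ → σ ⊆ τ → τ ≡ σ

  Adjacent : (d : ℕ) (K : Simplex → Set) → Simplex → Simplex → Set
  Adjacent d K β β' =
    K β × length β ≡ suc d × K β' × length β' ≡ suc d ×
    ∃ λ α → K α × length α ≡ d × α ⊆ β × α ⊆ β'

  record IsPseudomanifold (d : ℕ) (K : Simplex → Set) : Set where
    field
      complex   : IsComplex K
      pure      : ∀ σ → K σ → Maximal K σ → length σ ≡ suc d
      thin      : ∀ α → K α → length α ≡ d →
                  ∃ λ β₁ → ∃ λ β₂ →
                    (K β₁ × length β₁ ≡ suc d × α ⊆ β₁) ×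
                    (K β₂ × length β₂ ≡ suc d × α ⊆ β₂) ×
                    β₁ ≢ β₂ ×
                    (∀ β → K β → length β ≡ suc d → α ⊆ β → β ≡ β₁ ⊎ β ≡ β₂)
      connected : ∀ β β' → K β → length β ≡ suc d → K β' → length β' ≡ suc d →
                  Star (Adjacent d K) β β'

  record IsCombinatorialSphere (d : ℕ) (K : Simplex → Set) : Set₁ where
    field
      pseudomanifold : IsPseudomanifold d K
      field′         : Simplex → Simplex → Set
      isDVF          : IsDVF K field′
      gradient       : IsGradient field′
      topCritical    : Simplex
      vertCritical   : Simplex
      topIsCritical  : Critical K field′ topCritical × length topCritical ≡ suc d
      vertIsCritical : Critical K field′ vertCritical × length vertCritical ≡ 1
      distinct       : topCritical ≢ vertCritical
      onlyThese      : ∀ σ → Critical K field′ σ →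
                       σ ≡ topCritical ⊎ σ ≡ vertCritical

-- Its vertex type is List V (simplices of K),
-- ordered lexicographically; a simplex of Bd(K) is the (lexicographically
-- strictly increasing) list of its vertices v_σ, which must be nonempty
-- simplices of K forming a chain under inclusion.
module _ {V : Set} (_<_ : Rel V 0ℓ) where

  _<ₗ_ : Rel (List V) 0ℓ
  _<ₗ_ = Lex-< _≡_ _<_

  Bd : (List V → Set) → List (List V) → Set
  Bd K τ =
    Linked _<ₗ_ τ ×
    All (λ σ → K σ × σ ≢ []) τ ×
    AllPairs (λ σ σ' → σ ⊆ σ' ⊎ σ' ⊆ σ) τ

{-# OPTIONS --safe #-}
module Submission where

-- Bd(S) is again a pseudomanifold: a maximal chain has a face of every dimension; a chain missing one
-- dimension has exactly two completions (the two facets of S through a ridge, or the two faces between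
-- consecutive members of the chain); and a maximal chain is turned into the chain of suffixes of its top
-- face by adjacent exchanges, so connectedness of S carries over.
-- A chain a with top face T is paired with a ∪ {β} if (T, β) ∈ W, and with a ∪ {x ∪ τ}, τ the largest
-- member of a avoiding x, if either (α, T) ∈ W with α ∉ a and x the vertex T ∖ α, or T is the critical
-- facet t and x is the head of the shortest suffix of t lying in a together with all longer suffixes.
-- Only the suffix chain of t and the critical vertex stay unpaired. Along a closed trajectory the top
-- faces form a closed path in the modified Hasse diagram of W, impossible for a gradient field, unless
-- the top is constant; then every step cones with one vertex x, and the number of members of the chain
-- avoiding x drops.

open import Defs
open import Level using (0ℓ)
open import Function using (id; _∘_)
open import Data.Empty using (⊥; ⊥-elim)
open import Data.Product using (Σ; ∃; ∃-syntax; _×_; _,_; proj₁; proj₂)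
open import Data.Sum using (_⊎_; inj₁; inj₂)
open import Data.Nat using (ℕ; zero; suc; _+_; _∸_; _≤_; _<_; _≤?_; _<?_; z≤n; s≤s)
import Data.Nat as ℕ
open import Data.Nat.Properties
  using (≮⇒≥; 0≢1+n; 1+n≢n; ≤-pred; ≤-total; ≤-refl; ≤-trans; ≤-reflexive; ≤-antisym; ≤∧≢⇒<; <-irrefl; n<1+n; n≤1+n;
         ≰⇒>; <⇒≤; <-≤-trans; +-suc; +-monoˡ-≤; m≤n+m; m<m+n; m+[n∸m]≡n; +-identityʳ; <-cmp; <-isStrictTotalOrder; suc-injective)
open import Data.List using (List; []; _∷_; [_]; length; foldr; filter; map; applyUpTo; _++_)
open import Data.List.Properties using (filter-reject; length-map; length-applyUpTo; ≡-dec)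
open import Data.List.Extrema.Nat using (argmax; argmin; argmax-sel; argmin-sel; f[xs]≤f[argmax]; f[argmin]≤f[xs])
open import Data.List.Membership.Propositional using (_∈_; _∉_; find)
open import Data.List.Membership.Propositional.Properties
  using (∈-++⁺ˡ; ∈-++⁺ʳ; ∈-++⁻; ∈-map⁺; ∈-map⁻; ∈-applyUpTo⁺; ∈-applyUpTo⁻; ∈-filter⁺; ∈-filter⁻)
open import Data.List.Relation.Unary.Any using (here; there)
import Data.List.Relation.Unary.Any as Any
open import Data.List.Relation.Unary.Any.Properties using (¬Any[]; singleton⁻)
open import Data.List.Relation.Unary.All using (All; []; _∷_)
import Data.List.Relation.Unary.All as All
open import Data.List.Relation.Unary.All.Properties using (¬All⇒Any¬)
open import Data.List.Relation.Unary.AllPairs using (AllPairs; []; _∷_)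
import Data.List.Relation.Unary.AllPairs.Properties as AllPairsₚ
open import Data.List.Relation.Unary.Linked using (Linked; []; [-]; _∷_)
import Data.List.Relation.Unary.Linked as Linked
open import Data.List.Relation.Unary.Linked.Properties using (Linked⇒AllPairs)
import Data.List.Relation.Unary.Linked.Properties as Linkedₚ
open import Data.List.Relation.Binary.Subset.Propositional using (_⊆_)
open import Data.List.Relation.Binary.Subset.Propositional.Properties using (⊆-trans)
open import Data.List.Relation.Binary.Sublist.Propositional using ([]; _∷_; _∷ʳ_) renaming (_⊆_ to _⊑_)
open import Data.List.Relation.Binary.Sublist.Propositional.Properties using ([]⊆-universal; length-mono-≤; to-≋)
open import Data.List.Relation.Binary.Equality.Propositional using (≋⇒≡)
import Data.List.Relation.Binary.Lex.Strict as Lex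
open import Data.List.Relation.Binary.Pointwise using (Pointwise-≡⇒≡; ≡⇒Pointwise-≡)
open import Relation.Binary using (Rel; IsStrictTotalOrder; Tri; tri<; tri≈; tri>)
open import Relation.Binary.PropositionalEquality using (_≡_; _≢_; refl; sym; trans; cong; subst; subst₂; isEquivalence; resp₂)
open import Relation.Binary.Construct.Closure.Transitive using (TransClosure; _∷_) renaming ([_] to [_]⁺; _++_ to _++⁺_)
open import Relation.Binary.Construct.Closure.ReflexiveTransitive using (Star; ε; _◅_; _◅◅_; kleisliStar)
import Relation.Binary.Construct.Closure.ReflexiveTransitive as Star
open import Relation.Nullary using (¬_; Dec; yes; no; ¬?)
open import Relation.Nullary.Decidable using (¬¬-excluded-middle)
open import Relation.Unary using (Decidable)

suffixes : ∀ {A : Set} → List A → List (List A)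
suffixes [] = []
suffixes (x ∷ xs) = (x ∷ xs) ∷ suffixes xs

suffixes-self : ∀ {A : Set} {U : List A} → U ≢ [] → U ∈ suffixes U
suffixes-self {U = []} U≢[] = ⊥-elim (U≢[] refl)
suffixes-self {U = _ ∷ _} _ = here refl

suffix-⊆ : ∀ {A : Set} {ρ : List A} U → ρ ∈ suffixes U → ρ ⊆ U
suffix-⊆ (x ∷ xs) (here refl) = id
suffix-⊆ (x ∷ xs) (there ρ∈) = there ∘ suffix-⊆ xs ρ∈

suffix-length≤ : ∀ {A : Set} {ρ : List A} U → ρ ∈ suffixes U → length ρ ≤ length U
suffix-length≤ (x ∷ xs) (here refl) = ≤-refl
suffix-length≤ (x ∷ xs) (there ρ∈) = ≤-trans (suffix-length≤ xs ρ∈) (n≤1+n _)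

suffix-full-length : ∀ {A : Set} {ρ : List A} U → ρ ∈ suffixes U → length ρ ≡ length U → ρ ≡ U
suffix-full-length (x ∷ xs) (here refl) _ = refl
suffix-full-length (x ∷ xs) (there ρ∈) l = ⊥-elim (<-irrefl l (s≤s (suffix-length≤ xs ρ∈)))

suffix-nonempty : ∀ {A : Set} {ρ : List A} U → ρ ∈ suffixes U → ρ ≢ []
suffix-nonempty (x ∷ xs) (here refl) ()
suffix-nonempty (x ∷ xs) (there ρ∈) = suffix-nonempty xs ρ∈

suffixes-nested : ∀ {A : Set} {ρ ρ' : List A} U → ρ ∈ suffixes U → ρ' ∈ suffixes U → length ρ ≤ length ρ' → ρ ∈ suffixes ρ'
suffixes-nested (x ∷ xs) ρ∈ (here refl) _ = ρ∈
suffixes-nested (x ∷ xs) (here refl) (there ρ'∈) l = ⊥-elim (<-irrefl refl (≤-trans (s≤s (suffix-length≤ xs ρ'∈)) l))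
suffixes-nested (x ∷ xs) (there ρ∈) (there ρ'∈) l = suffixes-nested xs ρ∈ ρ'∈ l

suffix-tail : ∀ {A : Set} {x : A} {φ} U → (x ∷ φ) ∈ suffixes U → φ ≢ [] → φ ∈ suffixes U
suffix-tail (y ∷ []) (here refl) φ≢[] = ⊥-elim (φ≢[] refl)
suffix-tail (y ∷ z ∷ zs) (here refl) _ = there (here refl)
suffix-tail (y ∷ ys) (there x∷φ∈) φ≢[] = there (suffix-tail ys x∷φ∈ φ≢[])

suffix-of-length : ∀ {A : Set} (U : List A) {k} → 0 < k → k ≤ length U → ∃[ ψ ] ψ ∈ suffixes U × length ψ ≡ k
suffix-of-length [] 0<k k≤0 = ⊥-elim (<-irrefl refl (≤-trans 0<k k≤0))
suffix-of-length (x ∷ xs) {k} 0<k k≤ with k ℕ.≟ suc (length xs)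
... | yes refl = x ∷ xs , here refl , refl
... | no k≢ = let (ψ , ψ∈ , lψ) = suffix-of-length xs 0<k (≤-pred (≤∧≢⇒< k≤ k≢)) in ψ , there ψ∈ , lψ

suffixes-length-injective : ∀ {A : Set} {ρ ρ' : List A} U → ρ ∈ suffixes U → ρ' ∈ suffixes U → length ρ ≡ length ρ' → ρ ≡ ρ'
suffixes-length-injective {ρ = ρ} {ρ'} U ρ∈ ρ'∈ l = suffix-full-length ρ' (suffixes-nested U ρ∈ ρ'∈ (≤-reflexive l)) l

suffixes-comparable : ∀ {A : Set} {ρ ρ' : List A} U → ρ ∈ suffixes U → ρ' ∈ suffixes U → ρ ⊆ ρ' ⊎ ρ' ⊆ ρ
suffixes-comparable {ρ = ρ} {ρ'} U ρ∈ ρ'∈ with ≤-total (length ρ) (length ρ')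
... | inj₁ ρ≤ρ' = inj₁ (suffix-⊆ ρ' (suffixes-nested U ρ∈ ρ'∈ ρ≤ρ'))
... | inj₂ ρ'≤ρ = inj₂ (suffix-⊆ ρ (suffixes-nested U ρ'∈ ρ∈ ρ'≤ρ))

module SortedList {A : Set} {_≺_ : Rel A 0ℓ} (sto : IsStrictTotalOrder _≡_ _≺_) where

  open IsStrictTotalOrder sto public using (compare; _≟_)
  open IsStrictTotalOrder sto using () renaming (trans to ≺-trans; irrefl to ≺-irrefl′)
  open import Data.List.Membership.DecPropositional _≟_ public using (_∈?_)

  Sorted : List A → Set
  Sorted = Linked _≺_

  ≺-irrefl : ∀ {x} → ¬ x ≺ x
  ≺-irrefl = ≺-irrefl′ refl

  sorted-∷⁻ : ∀ {x xs} → Sorted (x ∷ xs) → All (x ≺_) xs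
  sorted-∷⁻ s with Linked⇒AllPairs ≺-trans s
  ... | x<xs ∷ _ = x<xs

  sorted-∷⁺ : ∀ {x xs} → All (x ≺_) xs → Sorted xs → Sorted (x ∷ xs)
  sorted-∷⁺ [] [] = [-]
  sorted-∷⁺ (x<y ∷ _) s = x<y ∷ s

  head<tail : ∀ {x xs y} → Sorted (x ∷ xs) → y ∈ xs → x ≺ y
  head<tail s = All.lookup (sorted-∷⁻ s)

  head∉tail : ∀ {x xs} → Sorted (x ∷ xs) → x ∉ xs
  head∉tail s x∈xs = ≺-irrefl (head<tail s x∈xs)

  ≻⇒≢ : ∀ {x y} → y ≺ x → x ≢ y
  ≻⇒≢ y<x refl = ≺-irrefl y<x

  suffix-sorted : ∀ {U ρ} → Sorted U → ρ ∈ suffixes U → Sorted ρ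
  suffix-sorted {_ ∷ _} s (here refl) = s
  suffix-sorted {_ ∷ _} s (there ρ∈) = suffix-sorted (Linked.tail s) ρ∈

  ⊆⇒⊑ : ∀ {xs ys} → Sorted xs → Sorted ys → xs ⊆ ys → xs ⊑ ys
  ⊆⇒⊑ {[]} _ _ _ = []⊆-universal _
  ⊆⇒⊑ {x ∷ xs} {[]} _ _ p with p (here refl)
  ... | ()
  ⊆⇒⊑ {x ∷ xs} {y ∷ ys} sx sy p with compare x y
  ... | tri< x<y x≢y _ = ⊥-elim (≺-irrefl (≺-trans x<y (head<tail sy (Any.tail x≢y (p (here refl))))))
  ... | tri≈ _ refl _ = refl ∷ ⊆⇒⊑ (Linked.tail sx) (Linked.tail sy) (λ z∈ → Any.tail (≻⇒≢ (head<tail sx z∈)) (p (there z∈)))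
  ... | tri> _ _ y<x = y ∷ʳ ⊆⇒⊑ sx (Linked.tail sy) tail⊆
    where
    tail⊆ : x ∷ xs ⊆ ys
    tail⊆ (here refl) = Any.tail (≻⇒≢ y<x) (p (here refl))
    tail⊆ (there z∈) = Any.tail (≻⇒≢ (≺-trans y<x (head<tail sx z∈))) (p (there z∈))

  ∷⊆∷⇒⊆ : ∀ {x xs y ys} → Sorted (x ∷ xs) → Sorted (y ∷ ys) → y ∷ ys ⊆ x ∷ xs → ys ⊆ xs
  ∷⊆∷⇒⊆ {x} {xs} {y} sx sy ⊆ {z} z∈ = Any.tail z≢x (⊆ (there z∈))
    where
    y<z = head<tail sy z∈
    z≢x : z ≢ x
    z≢x refl with ⊆ (here refl)
    ... | here refl = ≺-irrefl y<z
    ... | there y∈ = ≺-irrefl (≺-trans (head<tail sx y∈) y<z)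

  module _ {xs ys} (sx : Sorted xs) (sy : Sorted ys) where

    ⊆⇒length≤ : xs ⊆ ys → length xs ≤ length ys
    ⊆⇒length≤ p = length-mono-≤ (⊆⇒⊑ sx sy p)

    ⊆∧length≥⇒≡ : xs ⊆ ys → length ys ≤ length xs → xs ≡ ys
    ⊆∧length≥⇒≡ p l = ≋⇒≡ (to-≋ (≤-antisym (⊆⇒length≤ p) l) (⊆⇒⊑ sx sy p))

    ⊆-antisym : xs ⊆ ys → ys ⊆ xs → xs ≡ ys
    ⊆-antisym p q = ⊆∧length≥⇒≡ p (length-mono-≤ (⊆⇒⊑ sy sx q))

    ⊆∧≢⇒length< : xs ⊆ ys → xs ≢ ys → length xs < length ys
    ⊆∧≢⇒length< p xs≢ys = ≤∧≢⇒< (⊆⇒length≤ p) (λ e → xs≢ys (⊆∧length≥⇒≡ p (≤-reflexive (sym e))))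

    ⊆∧∉⇒length< : xs ⊆ ys → ∀ {y} → y ∈ ys → y ∉ xs → length xs < length ys
    ⊆∧∉⇒length< p y∈ys y∉xs = ⊆∧≢⇒length< p (λ { refl → y∉xs y∈ys })

    length<⇒∃∉ : length xs < length ys → ∃[ y ] y ∈ ys × y ∉ xs
    length<⇒∃∉ l with All.all? (_∈? xs) ys
    ... | yes ys⊆xs = ⊥-elim (<-irrefl refl (≤-trans l (length-mono-≤ (⊆⇒⊑ sy sx (All.lookup ys⊆xs)))))
    ... | no ¬ys⊆xs = find (¬All⇒Any¬ (_∈? xs) ys ¬ys⊆xs)

  insert : A → List A → List A
  insert x [] = [ x ]
  insert x (y ∷ ys) with compare x y
  ... | tri< _ _ _ = x ∷ y ∷ ys
  ... | tri≈ _ _ _ = y ∷ ys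
  ... | tri> _ _ _ = y ∷ insert x ys

  ∈-insert-self : ∀ x ys → x ∈ insert x ys
  ∈-insert-self x [] = here refl
  ∈-insert-self x (y ∷ ys) with compare x y
  ... | tri< _ _ _ = here refl
  ... | tri≈ _ x≡y _ = here x≡y
  ... | tri> _ _ _ = there (∈-insert-self x ys)

  ∈-insert⁺ : ∀ {z} x ys → z ∈ ys → z ∈ insert x ys
  ∈-insert⁺ x (y ∷ ys) z∈ with compare x y
  ... | tri< _ _ _ = there z∈
  ... | tri≈ _ _ _ = z∈
  ∈-insert⁺ x (y ∷ ys) (here z≡y) | tri> _ _ _ = here z≡y
  ∈-insert⁺ x (y ∷ ys) (there z∈) | tri> _ _ _ = there (∈-insert⁺ x ys z∈)

  ∈-insert⁻ : ∀ {z} x ys → z ∈ insert x ys → z ≡ x ⊎ z ∈ ys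
  ∈-insert⁻ x [] (here z≡x) = inj₁ z≡x
  ∈-insert⁻ x (y ∷ ys) z∈ with compare x y
  ∈-insert⁻ x (y ∷ ys) (here z≡x) | tri< _ _ _ = inj₁ z≡x
  ∈-insert⁻ x (y ∷ ys) (there z∈) | tri< _ _ _ = inj₂ z∈
  ∈-insert⁻ x (y ∷ ys) z∈ | tri≈ _ _ _ = inj₂ z∈
  ∈-insert⁻ x (y ∷ ys) (here z≡y) | tri> _ _ _ = inj₂ (here z≡y)
  ∈-insert⁻ x (y ∷ ys) (there z∈) | tri> _ _ _ with ∈-insert⁻ x ys z∈
  ... | inj₁ z≡x = inj₁ z≡x
  ... | inj₂ z∈ys = inj₂ (there z∈ys)

  insert-sorted : ∀ x {ys} → Sorted ys → Sorted (insert x ys)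
  insert-sorted x {[]} _ = [-]
  insert-sorted x {y ∷ ys} s with compare x y
  ... | tri< x<y _ _ = x<y ∷ s
  ... | tri≈ _ _ _ = s
  ... | tri> _ _ y<x = sorted-∷⁺ (All.tabulate y<) (insert-sorted x (Linked.tail s))
    where
    y< : ∀ {z} → z ∈ insert x ys → y ≺ z
    y< z∈ with ∈-insert⁻ x ys z∈
    ... | inj₁ refl = y<x
    ... | inj₂ z∈ys = head<tail s z∈ys

  length-insert : ∀ x ys → x ∉ ys → length (insert x ys) ≡ suc (length ys)
  length-insert x [] _ = refl
  length-insert x (y ∷ ys) x∉ with compare x y
  ... | tri< _ _ _ = refl
  ... | tri≈ _ x≡y _ = ⊥-elim (x∉ (here x≡y))
  ... | tri> _ _ _ = cong suc (length-insert x ys (x∉ ∘ there))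

  insert-head : ∀ {x xs} → Sorted (x ∷ xs) → insert x xs ≡ x ∷ xs
  insert-head {x} {[]} _ = refl
  insert-head {x} {y ∷ ys} s with compare x y
  ... | tri< _ _ _ = refl
  ... | tri≈ _ x≡y _ = ⊥-elim (head∉tail s (here x≡y))
  ... | tri> _ _ y<x = ⊥-elim (≺-irrefl (≺-trans y<x (head<tail s (here refl))))

  module _ {xs} (sx : Sorted xs) where

    insert-missing : ∀ {x} → x ∈ xs → ∀ {ys} → Sorted ys → ys ⊆ xs → suc (length ys) ≡ length xs → x ∉ ys →
                     insert x ys ≡ xs
    insert-missing {x} x∈ {ys} sy ys⊆ l x∉ =
      ⊆∧length≥⇒≡ (insert-sorted x sy) sx ⊆xs (≤-reflexive (trans (sym l) (sym (length-insert x ys x∉))))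
      where
      ⊆xs : insert x ys ⊆ xs
      ⊆xs z∈ with ∈-insert⁻ x ys z∈
      ... | inj₁ refl = x∈
      ... | inj₂ z∈ys = ys⊆ z∈ys

  two-between : ∀ {lo hi} → Sorted lo → Sorted hi → lo ⊆ hi → length hi ≡ 2 + length lo →
                ∃[ u ] ∃[ v ] u ≢ v × u ∉ lo × v ∉ lo × u ∈ hi × v ∈ hi ×
                  (∀ {γ} → Sorted γ → lo ⊆ γ → γ ⊆ hi → length γ ≡ suc (length lo) → γ ≡ insert u lo ⊎ γ ≡ insert v lo)
  two-between {lo} {hi} sl sh lo⊆ lhi with length<⇒∃∉ sl sh (≤-trans (n≤1+n _) (≤-reflexive (sym lhi)))
  ... | u , u∈hi , u∉lo
    with length<⇒∃∉ (insert-sorted u sl) sh (≤-reflexive (sym (trans lhi (cong suc (sym (length-insert u lo u∉lo))))))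
  ... | v , v∈hi , v∉ =
    u , v , (λ { refl → v∉ (∈-insert-self u lo) }) , u∉lo , v∉ ∘ ∈-insert⁺ u lo , u∈hi , v∈hi , between
    where
    ⊆hi : ∀ {y} → y ∈ hi → insert y lo ⊆ hi
    ⊆hi y∈ z∈ with ∈-insert⁻ _ lo z∈
    ... | inj₁ refl = y∈
    ... | inj₂ z∈lo = lo⊆ z∈lo
    hi≡ : insert v (insert u lo) ≡ hi
    hi≡ = insert-missing sh v∈hi (insert-sorted u sl) (⊆hi u∈hi)
            (trans (cong suc (length-insert u lo u∉lo)) (sym lhi)) v∉
    between : ∀ {γ} → Sorted γ → lo ⊆ γ → γ ⊆ hi → length γ ≡ suc (length lo) → γ ≡ insert u lo ⊎ γ ≡ insert v lo
    between {γ} sγ lo⊆γ γ⊆ lγ with length<⇒∃∉ sl sγ (≤-reflexive (sym lγ))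
    ... | y , y∈γ , y∉lo with γ≡ ← sym (insert-missing sγ y∈γ sl lo⊆γ (sym lγ) y∉lo)
                        | ∈-insert⁻ v (insert u lo) (subst (y ∈_) (sym hi≡) (γ⊆ y∈γ))
    ... | inj₁ refl = inj₂ γ≡
    ... | inj₂ y∈ with ∈-insert⁻ u lo y∈
    ...   | inj₁ refl = inj₁ γ≡
    ...   | inj₂ y∈lo = ⊥-elim (y∉lo y∈lo)

  ⊆∧length≡suc⇒insert : ∀ {xs ys} → Sorted xs → Sorted ys → xs ⊆ ys → suc (length xs) ≡ length ys →
                        ∃[ x ] x ∉ xs × insert x xs ≡ ys
  ⊆∧length≡suc⇒insert sx sy xs⊆ l with length<⇒∃∉ sx sy (≤-reflexive l)
  ... | x , x∈ys , x∉xs = x , x∉xs , insert-missing sy x∈ys sx xs⊆ l x∉xs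

  filter-insert : ∀ {P : A → Set} (P? : Decidable P) {x} ys → ¬ P x → filter P? (insert x ys) ≡ filter P? ys
  filter-insert P? {x} [] ¬Px = filter-reject P? ¬Px
  filter-insert P? {x} (y ∷ ys) ¬Px with compare x y
  ... | tri< _ _ _ = filter-reject P? ¬Px
  ... | tri≈ _ _ _ = refl
  ... | tri> _ _ _ with P? y
  ...   | yes _ = cong (y ∷_) (filter-insert P? ys ¬Px)
  ...   | no _ = filter-insert P? ys ¬Px

  insert-injectiveʳ : ∀ {x ys zs} → Sorted ys → Sorted zs → x ∉ ys → x ∉ zs → insert x ys ≡ insert x zs → ys ≡ zs
  insert-injectiveʳ {x} {ys} {zs} sy sz x∉ys x∉zs e = ⊆-antisym sy sz (into x∉ys e) (into x∉zs (sym e))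
    where
    into : ∀ {us vs} → x ∉ us → insert x us ≡ insert x vs → us ⊆ vs
    into {us} {vs} x∉us e′ {z} z∈ with ∈-insert⁻ x vs (subst (z ∈_) e′ (∈-insert⁺ x us z∈))
    ... | inj₁ refl = ⊥-elim (x∉us z∈)
    ... | inj₂ z∈vs = z∈vs

  insert-injectiveˡ : ∀ {x y zs} → x ∉ zs → insert x zs ≡ insert y zs → x ≡ y
  insert-injectiveˡ {x} {y} {zs} x∉ e with ∈-insert⁻ y zs (subst (x ∈_) e (∈-insert-self x zs))
  ... | inj₁ x≡y = x≡y
  ... | inj₂ x∈ = ⊥-elim (x∉ x∈)

  ⊆-interpolate : ∀ {lo hi k} → Sorted lo → Sorted hi → lo ⊆ hi → length lo ≤ k → k ≤ length hi →
                  ∃[ γ ] Sorted γ × lo ⊆ γ × γ ⊆ hi × length γ ≡ k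
  ⊆-interpolate {lo} {hi} {k} sl sh lo⊆ l₁ l₂ = go (k ∸ length lo) sl lo⊆ (m+[n∸m]≡n l₁)
    where
    go : ∀ n {lo} → Sorted lo → lo ⊆ hi → length lo + n ≡ k → ∃[ γ ] Sorted γ × lo ⊆ γ × γ ⊆ hi × length γ ≡ k
    go zero {lo} sl lo⊆ e = lo , sl , id , lo⊆ , trans (sym (+-identityʳ _)) e
    go (suc n) {lo} sl lo⊆ e with length<⇒∃∉ sl sh (≤-trans (≤-trans (m<m+n _ (s≤s z≤n)) (≤-reflexive e)) l₂)
    ... | y , y∈hi , y∉lo with go n (insert-sorted y sl) insert⊆ (trans (cong (_+ n) (length-insert y lo y∉lo)) (trans (sym (+-suc _ n)) e))
      where
      insert⊆ : insert y lo ⊆ hi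
      insert⊆ z∈ with ∈-insert⁻ y lo z∈
      ... | inj₁ refl = y∈hi
      ... | inj₂ z∈lo = lo⊆ z∈lo
    ...   | γ , sγ , ⊆γ , γ⊆ , lγ = γ , sγ , ⊆γ ∘ ∈-insert⁺ y lo , γ⊆ , lγ

  remove : A → List A → List A
  remove y = filter (λ z → ¬? (z ≟ y))

  ∈-remove⁺ : ∀ {y z} xs → z ∈ xs → z ≢ y → z ∈ remove y xs
  ∈-remove⁺ _ = ∈-filter⁺ (λ z → ¬? (z ≟ _))

  ∈-remove⁻ : ∀ {y z} xs → z ∈ remove y xs → z ∈ xs × z ≢ y
  ∈-remove⁻ xs = ∈-filter⁻ (λ z → ¬? (z ≟ _)) {xs = xs}

  remove-sorted : ∀ y {xs} → Sorted xs → Sorted (remove y xs)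
  remove-sorted y = Linkedₚ.filter⁺ (λ z → ¬? (z ≟ y)) ≺-trans

  insert-remove : ∀ {y xs} → Sorted xs → y ∈ xs → insert y (remove y xs) ≡ xs
  insert-remove {y} {xs} sx y∈ = ⊆-antisym (insert-sorted y (remove-sorted y sx)) sx ⊆xs xs⊆
    where
    ⊆xs : insert y (remove y xs) ⊆ xs
    ⊆xs z∈ with ∈-insert⁻ y (remove y xs) z∈
    ... | inj₁ refl = y∈
    ... | inj₂ z∈′ = proj₁ (∈-remove⁻ xs z∈′)
    xs⊆ : xs ⊆ insert y (remove y xs)
    xs⊆ {z} z∈ with z ≟ y
    ... | yes refl = ∈-insert-self y (remove y xs)
    ... | no z≢y = ∈-insert⁺ y (remove y xs) (∈-remove⁺ xs z∈ z≢y)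

  fromList : List A → List A
  fromList = foldr insert []

  fromList-sorted : ∀ xs → Sorted (fromList xs)
  fromList-sorted [] = []
  fromList-sorted (x ∷ xs) = insert-sorted x (fromList-sorted xs)

  ∈-fromList⁺ : ∀ {z} xs → z ∈ xs → z ∈ fromList xs
  ∈-fromList⁺ (x ∷ xs) (here refl) = ∈-insert-self x (fromList xs)
  ∈-fromList⁺ (x ∷ xs) (there z∈) = ∈-insert⁺ x (fromList xs) (∈-fromList⁺ xs z∈)

  ∈-fromList⁻ : ∀ {z} xs → z ∈ fromList xs → z ∈ xs
  ∈-fromList⁻ (x ∷ xs) z∈ with ∈-insert⁻ x (fromList xs) z∈
  ... | inj₁ refl = here refl
  ... | inj₂ z∈′ = there (∈-fromList⁻ xs z∈′)

  length-fromList : ∀ {xs} → AllPairs _≢_ xs → length (fromList xs) ≡ length xs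
  length-fromList {[]} [] = refl
  length-fromList {x ∷ xs} (x≢xs ∷ u) =
    trans (length-insert x (fromList xs) (λ x∈ → All.lookup x≢xs (∈-fromList⁻ xs x∈) refl)) (cong suc (length-fromList u))

  sublists : List A → List (List A)
  sublists [] = [ [] ]
  sublists (y ∷ ys) = map (y ∷_) (sublists ys) ++ sublists ys

  ∈-sublists : ∀ {xs ys} → xs ⊑ ys → xs ∈ sublists ys
  ∈-sublists [] = here refl
  ∈-sublists (y ∷ʳ p) = ∈-++⁺ʳ _ (∈-sublists p)
  ∈-sublists (refl ∷ p) = ∈-++⁺ˡ (∈-map⁺ (_ ∷_) (∈-sublists p))

lex-isStrictTotalOrder : {V : Set} {_≺_ : Rel V 0ℓ} → IsStrictTotalOrder _≡_ _≺_ → IsStrictTotalOrder _≡_ (_<ₗ_ _≺_)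
lex-isStrictTotalOrder {V} {_≺_} sto = record
  { isStrictPartialOrder = record
    { isEquivalence = isEquivalence
    ; irrefl = λ e → L.irrefl (≡⇒Pointwise-≡ e)
    ; trans = L.trans
    ; <-resp-≈ = resp₂ (_<ₗ_ _≺_)
    }
  ; compare = compare
  }
  where
  module L = IsStrictTotalOrder (Lex.<-isStrictTotalOrder sto)
  compare : (xs ys : List V) → Tri (_<ₗ_ _≺_ xs ys) (xs ≡ ys) (_<ₗ_ _≺_ ys xs)
  compare xs ys with L.compare xs ys
  ... | tri< lt ne gt = tri< lt (ne ∘ ≡⇒Pointwise-≡) gt
  ... | tri≈ lt eq gt = tri≈ lt (Pointwise-≡⇒≡ eq) gt
  ... | tri> lt ne gt = tri> lt (ne ∘ ≡⇒Pointwise-≡) gt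

module Chains {V : Set} {_≺_ : Rel V 0ℓ} (sto : IsStrictTotalOrder _≡_ _≺_) {S : List V → Set} (K : IsComplex _≺_ S) where

  open IsComplex K public
  module Vtx = SortedList sto
  module Chn = SortedList (lex-isStrictTotalOrder sto)

  Chain : Set
  Chain = List (List V)

  BdS : Chain → Set
  BdS = Bd _≺_ S

  Comparable : List V → List V → Set
  Comparable ρ ρ' = ρ ⊆ ρ' ⊎ ρ' ⊆ ρ

  comparable⇒⊆ : ∀ {ρ ρ'} → Vtx.Sorted ρ → Vtx.Sorted ρ' → Comparable ρ ρ' → length ρ ≤ length ρ' → ρ ⊆ ρ'
  comparable⇒⊆ s s' (inj₁ ρ⊆ρ') l = ρ⊆ρ'
  comparable⇒⊆ s s' (inj₂ ρ'⊆ρ) l with Vtx.⊆∧length≥⇒≡ s' s ρ'⊆ρ l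
  ... | refl = id

  ⊂⇒length< : ∀ {σ τ} → S σ → S τ → σ ⊆ τ → σ ≢ τ → length σ < length τ
  ⊂⇒length< sσ sτ = Vtx.⊆∧≢⇒length< (canonical sσ) (canonical sτ)

  nonempty⇒length>0 : ∀ {ρ : List V} → ρ ≢ [] → 0 < length ρ
  nonempty⇒length>0 {[]} ρ≢[] = ⊥-elim (ρ≢[] refl)
  nonempty⇒length>0 {_ ∷ _} _ = s≤s z≤n

  module _ {c} (b : BdS c) where

    ∈⇒S : ∀ {ρ} → ρ ∈ c → S ρ
    ∈⇒S ρ∈ = proj₁ (All.lookup (proj₁ (proj₂ b)) ρ∈)

    ∈⇒nonempty : ∀ {ρ} → ρ ∈ c → ρ ≢ []
    ∈⇒nonempty ρ∈ = proj₂ (All.lookup (proj₁ (proj₂ b)) ρ∈)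

    ∈⇒sorted : ∀ {ρ} → ρ ∈ c → Vtx.Sorted ρ
    ∈⇒sorted = canonical ∘ ∈⇒S

    ∈⇒comparable : ∀ {ρ ρ'} → ρ ∈ c → ρ' ∈ c → Comparable ρ ρ'
    ∈⇒comparable = lookup (proj₂ (proj₂ b))
      where
      lookup : ∀ {c ρ ρ'} → AllPairs Comparable c → ρ ∈ c → ρ' ∈ c → Comparable ρ ρ'
      lookup (_ ∷ _) (here refl) (here refl) = inj₁ id
      lookup (ρ~ ∷ _) (here refl) (there ρ'∈) = All.lookup ρ~ ρ'∈
      lookup (ρ'~ ∷ _) (there ρ∈) (here refl) with All.lookup ρ'~ ρ∈
      ... | inj₁ ρ'⊆ρ = inj₂ ρ'⊆ρ
      ... | inj₂ ρ⊆ρ' = inj₁ ρ⊆ρ'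
      lookup (_ ∷ r) (there ρ∈) (there ρ'∈) = lookup r ρ∈ ρ'∈

    length≤⇒⊆ : ∀ {ρ ρ'} → ρ ∈ c → ρ' ∈ c → length ρ ≤ length ρ' → ρ ⊆ ρ'
    length≤⇒⊆ ρ∈ ρ'∈ = comparable⇒⊆ (∈⇒sorted ρ∈) (∈⇒sorted ρ'∈) (∈⇒comparable ρ∈ ρ'∈)

    length-injective : ∀ {ρ ρ'} → ρ ∈ c → ρ' ∈ c → length ρ ≡ length ρ' → ρ ≡ ρ'
    length-injective ρ∈ ρ'∈ e =
      Vtx.⊆∧length≥⇒≡ (∈⇒sorted ρ∈) (∈⇒sorted ρ'∈) (length≤⇒⊆ ρ∈ ρ'∈ (≤-reflexive e)) (≤-reflexive (sym e))

  mkBd : ∀ {c} → Chn.Sorted c → (∀ {ρ} → ρ ∈ c → S ρ × ρ ≢ []) →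
         (∀ {ρ ρ'} → ρ ∈ c → ρ' ∈ c → Comparable ρ ρ') → BdS c
  mkBd s el cmp = s , All.tabulate el , pairs cmp
    where
    pairs : ∀ {c} → (∀ {ρ ρ'} → ρ ∈ c → ρ' ∈ c → Comparable ρ ρ') → AllPairs Comparable c
    pairs {[]} _ = []
    pairs {_ ∷ _} cmp = All.tabulate (cmp (here refl) ∘ there) ∷ pairs (λ p q → cmp (there p) (there q))

  Bd-isComplex : IsComplex (_<ₗ_ _≺_) BdS
  Bd-isComplex = record
    { canonical = proj₁
    ; finite = Chn.sublists all ,
               λ b → Chn.∈-sublists (Chn.⊆⇒⊑ (proj₁ b) (Chn.fromList-sorted L) (Chn.∈-fromList⁺ L ∘ proj₂ finite ∘ ∈⇒S b))
    ; hasEmpty = [] , [] , []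
    ; downClosed = λ b s c⊆ → mkBd s (All.lookup (proj₁ (proj₂ b)) ∘ c⊆) (λ p q → ∈⇒comparable b (c⊆ p) (c⊆ q))
    }
    where
    L = proj₁ finite
    all = Chn.fromList L

  Bd-⊆ : ∀ {c c'} → BdS c → Chn.Sorted c' → c' ⊆ c → BdS c'
  Bd-⊆ = IsComplex.downClosed Bd-isComplex

  filter-Bd : ∀ {P : List V → Set} (P? : Decidable P) {c} → BdS c → BdS (filter P? c)
  filter-Bd P? {c} b = Bd-⊆ b (Linkedₚ.filter⁺ P? (IsStrictTotalOrder.trans (lex-isStrictTotalOrder sto)) (proj₁ b))
                          (proj₁ ∘ ∈-filter⁻ P? {xs = c})

  insert-Bd : ∀ {c σ} → BdS c → S σ → σ ≢ [] → (∀ {ρ} → ρ ∈ c → Comparable ρ σ) → BdS (Chn.insert σ c)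
  insert-Bd {c} {σ} b sσ σ≢[] σ~ = mkBd (Chn.insert-sorted σ (proj₁ b)) el cmp
    where
    el : ∀ {ρ} → ρ ∈ Chn.insert σ c → S ρ × ρ ≢ []
    el ρ∈ with Chn.∈-insert⁻ σ c ρ∈
    ... | inj₁ refl = sσ , σ≢[]
    ... | inj₂ ρ∈c = ∈⇒S b ρ∈c , ∈⇒nonempty b ρ∈c
    swap : ∀ {ρ ρ'} → Comparable ρ ρ' → Comparable ρ' ρ
    swap (inj₁ p) = inj₂ p
    swap (inj₂ p) = inj₁ p
    cmp : ∀ {ρ ρ'} → ρ ∈ Chn.insert σ c → ρ' ∈ Chn.insert σ c → Comparable ρ ρ'
    cmp p q with Chn.∈-insert⁻ σ c p | Chn.∈-insert⁻ σ c q
    ... | inj₁ refl | inj₁ refl = inj₁ id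
    ... | inj₁ refl | inj₂ q′ = swap (σ~ q′)
    ... | inj₂ p′ | inj₁ refl = σ~ p′
    ... | inj₂ p′ | inj₂ q′ = ∈⇒comparable b p′ q′

  remove-Bd : ∀ {c} σ → BdS c → BdS (Chn.remove σ c)
  remove-Bd {c} σ b = Bd-⊆ b (Chn.remove-sorted σ (proj₁ b)) (proj₁ ∘ Chn.∈-remove⁻ c)

  insert-isFacet : ∀ {c σ} → σ ∉ c → IsFacet (_<ₗ_ _≺_) c (Chn.insert σ c)
  insert-isFacet {c} {σ} σ∉ = Chn.∈-insert⁺ σ c , sym (Chn.length-insert σ c σ∉)

  opaque

    top : Chain → List V
    top = argmax length []

    top-sel : ∀ c → top c ≡ [] ⊎ top c ∈ c
    top-sel = argmax-sel length []

    length≤top : ∀ {c ρ} → ρ ∈ c → length ρ ≤ length (top c)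
    length≤top {c} = All.lookup (f[xs]≤f[argmax] [] c)

    bottom : Chain → List V
    bottom c = argmin length (top c) c

    bottom-sel : ∀ c → bottom c ≡ top c ⊎ bottom c ∈ c
    bottom-sel c = argmin-sel length (top c) c

    length-bottom≤ : ∀ {c ρ} → ρ ∈ c → length (bottom c) ≤ length ρ
    length-bottom≤ {c} = All.lookup (f[argmin]≤f[xs] (top c) c)

  module _ {c} (b : BdS c) where

    top-∈ : ∀ {ρ} → ρ ∈ c → top c ∈ c
    top-∈ ρ∈ with top-sel c
    ... | inj₂ top∈ = top∈
    ... | inj₁ top≡[] = ⊥-elim (<-irrefl refl (≤-trans (nonempty⇒length>0 (∈⇒nonempty b ρ∈))
                                   (≤-trans (length≤top ρ∈) (≤-reflexive (cong length top≡[])))))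

    ⊆-top : ∀ {ρ} → ρ ∈ c → ρ ⊆ top c
    ⊆-top ρ∈ = length≤⇒⊆ b ρ∈ (top-∈ ρ∈) (length≤top ρ∈)

    top≢[]⇒top∈ : top c ≢ [] → top c ∈ c
    top≢[]⇒top∈ top≢[] with top-sel c
    ... | inj₁ top≡[] = ⊥-elim (top≢[] top≡[])
    ... | inj₂ top∈ = top∈

    top-unique : ∀ {σ} → σ ∈ c → (∀ {ρ} → ρ ∈ c → ρ ⊆ σ) → top c ≡ σ
    top-unique σ∈ ⊆σ = Vtx.⊆-antisym (∈⇒sorted b (top-∈ σ∈)) (∈⇒sorted b σ∈) (⊆σ (top-∈ σ∈)) (⊆-top σ∈)

    bottom-∈ : ∀ {ρ} → ρ ∈ c → bottom c ∈ c
    bottom-∈ ρ∈ with bottom-sel c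
    ... | inj₁ bottom≡top = subst (_∈ c) (sym bottom≡top) (top-∈ ρ∈)
    ... | inj₂ bottom∈ = bottom∈

    bottom-⊆ : ∀ {ρ} → ρ ∈ c → bottom c ⊆ ρ
    bottom-⊆ ρ∈ = length≤⇒⊆ b (bottom-∈ ρ∈) ρ∈ (length-bottom≤ ρ∈)

  top≡⇒∈ : ∀ {c σ} → BdS c → top c ≡ σ → σ ≢ [] → σ ∈ c
  top≡⇒∈ b top≡σ σ≢[] = subst (_∈ _) top≡σ (top≢[]⇒top∈ b (σ≢[] ∘ trans (sym top≡σ)))

  ≢[]⇒top∈ : ∀ {c} → BdS c → c ≢ [] → top c ∈ c
  ≢[]⇒top∈ {[]} _ c≢[] = ⊥-elim (c≢[] refl)
  ≢[]⇒top∈ {_ ∷ _} b _ = top-∈ b (here refl)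

  remove-top : ∀ {c σ} → BdS c → σ ∈ c → σ ≢ top c → top (Chn.remove σ c) ≡ top c
  remove-top {c} {σ} b σ∈ σ≢top =
    top-unique (remove-Bd σ b) (Chn.∈-remove⁺ c (top-∈ b σ∈) (σ≢top ∘ sym)) (⊆-top b ∘ proj₁ ∘ Chn.∈-remove⁻ c)

  top-[] : top [] ≡ []
  top-[] with top-sel []
  ... | inj₁ top≡[] = top≡[]
  ... | inj₂ ()

  suffixFlag : List V → Chain
  suffixFlag T = Chn.fromList (suffixes T)

  suffix-S : ∀ {U ρ} → S U → ρ ∈ suffixes U → S ρ
  suffix-S {U} sU ρ∈ = downClosed sU (Vtx.suffix-sorted (canonical sU) ρ∈) (suffix-⊆ U ρ∈)

  suffixFlag-Bd : ∀ {T} → S T → BdS (suffixFlag T)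
  suffixFlag-Bd {T} sT = mkBd (Chn.fromList-sorted (suffixes T)) el cmp
    where
    el : ∀ {ρ} → ρ ∈ suffixFlag T → S ρ × ρ ≢ []
    el ρ∈ = suffix-S sT (Chn.∈-fromList⁻ (suffixes T) ρ∈) , suffix-nonempty T (Chn.∈-fromList⁻ (suffixes T) ρ∈)
    cmp : ∀ {ρ ρ'} → ρ ∈ suffixFlag T → ρ' ∈ suffixFlag T → Comparable ρ ρ'
    cmp ρ∈ ρ'∈ = suffixes-comparable T (Chn.∈-fromList⁻ (suffixes T) ρ∈) (Chn.∈-fromList⁻ (suffixes T) ρ'∈)

  top-suffixFlag : ∀ {T} → S T → T ≢ [] → top (suffixFlag T) ≡ T
  top-suffixFlag {[]} _ T≢[] = ⊥-elim (T≢[] refl)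
  top-suffixFlag {T@(_ ∷ _)} sT _ =
    top-unique (suffixFlag-Bd sT) (Chn.∈-fromList⁺ (suffixes T) (here refl)) (suffix-⊆ T ∘ Chn.∈-fromList⁻ (suffixes T))

module BdPseudomanifold {V : Set} {_≺_ : Rel V 0ℓ} (sto : IsStrictTotalOrder _≡_ _≺_) {d : ℕ} {S : List V → Set}
                        (PM : IsPseudomanifold _≺_ d S) where

  open IsPseudomanifold PM
  open Chains sto complex public
  module Nat = SortedList <-isStrictTotalOrder

  ⊂-induction : (P : List V → Set) → (∀ {σ} → S σ → (∀ {τ} → S τ → σ ⊆ τ → σ ≢ τ → P τ) → P σ) →
                ∀ {σ} → S σ → P σ
  ⊂-induction P step {σ} sσ = go _ sσ (m≤n+m bound (length σ))
    where
    bound : ℕ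
    bound = length (top (proj₁ finite))
    length≤bound : ∀ {τ} → S τ → length τ ≤ bound
    length≤bound sτ = length≤top (proj₂ finite sτ)
    go : ∀ m {σ} → S σ → bound ≤ length σ + m → P σ
    go zero {σ} sσ b = step sσ λ sτ σ⊆τ σ≢τ → ⊥-elim (<-irrefl refl (≤-trans (⊂⇒length< sσ sτ σ⊆τ σ≢τ)
                         (≤-trans (length≤bound sτ) (≤-trans b (≤-reflexive (+-identityʳ _))))))
    go (suc m) {σ} sσ b = step sσ λ sτ σ⊆τ σ≢τ →
      go m sτ (≤-trans b (≤-trans (≤-reflexive (+-suc _ m)) (+-monoˡ-≤ m (⊂⇒length< sσ sτ σ⊆τ σ≢τ))))

  no-⊃⇒length≡ : ∀ {σ} → S σ → (∀ {τ} → S τ → σ ⊆ τ → σ ≢ τ → ⊥) → length σ ≡ suc d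
  no-⊃⇒length≡ {σ} sσ no⊃ = pure σ sσ maximal
    where
    maximal : Maximal _≺_ S σ
    maximal τ sτ σ⊆τ with τ Chn.≟ σ
    ... | yes τ≡σ = τ≡σ
    ... | no τ≢σ = ⊥-elim (no⊃ sτ σ⊆τ (τ≢σ ∘ sym))

  length≤ : ∀ {σ} → S σ → length σ ≤ suc d
  length≤ = ⊂-induction (λ σ → length σ ≤ suc d) step
    where
    step : ∀ {σ} → S σ → (∀ {τ} → S τ → σ ⊆ τ → σ ≢ τ → length τ ≤ suc d) → length σ ≤ suc d
    step {σ} sσ ih with length σ ≤? suc d
    ... | yes l = l
    ... | no l = ⊥-elim (l (≤-reflexive (no-⊃⇒length≡ sσ λ sτ σ⊆τ σ≢τ →
                   l (<⇒≤ (≤-trans (⊂⇒length< sσ sτ σ⊆τ σ≢τ) (ih sτ σ⊆τ σ≢τ))))))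

  -- Maximality in S is not decidable, so a facet through σ is only found up to double negation.
  InFacet : List V → Set
  InFacet σ = ∃[ τ ] S τ × length τ ≡ suc d × σ ⊆ τ

  in-facet : ∀ {σ} → S σ → ¬ ¬ InFacet σ
  in-facet = ⊂-induction (λ σ → ¬ ¬ InFacet σ) step
    where
    step : ∀ {σ} → S σ → (∀ {τ} → S τ → σ ⊆ τ → σ ≢ τ → ¬ ¬ InFacet τ) → ¬ ¬ InFacet σ
    step {σ} sσ ih k with length σ ℕ.≟ suc d
    ... | yes l = k (σ , sσ , l , id)
    ... | no l = l (no-⊃⇒length≡ sσ λ sτ σ⊆τ σ≢τ →
                   ih sτ σ⊆τ σ≢τ λ (τ′ , sτ′ , lτ′ , τ⊆τ′) → k (τ′ , sτ′ , lτ′ , ⊆-trans σ⊆τ τ⊆τ′))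

  Full : Chain → Set
  Full c = BdS c × length c ≡ suc d

  range : List ℕ
  range = applyUpTo suc (suc d)

  range-sorted : Nat.Sorted range
  range-sorted = Linkedₚ.applyUpTo⁺₂ suc (suc d) (λ _ → ≤-refl)

  ∈-range⁺ : ∀ {k} → 0 < k → k ≤ suc d → k ∈ range
  ∈-range⁺ {suc k} _ k<1+d = ∈-applyUpTo⁺ suc k<1+d

  ∈-range⁻ : ∀ {k} → k ∈ range → 0 < k × k ≤ suc d
  ∈-range⁻ k∈ with ∈-applyUpTo⁻ suc k∈
  ... | _ , i<1+d , refl = s≤s z≤n , i<1+d

  lengths : Chain → List ℕ
  lengths c = Nat.fromList (map length c)

  lengths-sorted : ∀ c → Nat.Sorted (lengths c)
  lengths-sorted c = Nat.fromList-sorted (map length c)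

  ∈-lengths⁺ : ∀ {c ρ} → ρ ∈ c → length ρ ∈ lengths c
  ∈-lengths⁺ {c} ρ∈ = Nat.∈-fromList⁺ (map length c) (∈-map⁺ length ρ∈)

  ∈-lengths⁻ : ∀ {c k} → k ∈ lengths c → ∃[ ρ ] ρ ∈ c × length ρ ≡ k
  ∈-lengths⁻ {c} k∈ with ∈-map⁻ length (Nat.∈-fromList⁻ (map length c) k∈)
  ... | ρ , ρ∈ , refl = ρ , ρ∈ , refl

  module _ {c} (b : BdS c) where

    length-lengths : length (lengths c) ≡ length c
    length-lengths = trans (Nat.length-fromList (AllPairsₚ.map⁺ (distinct id (Linkedₚ.Linked⇒AllPairs Chn-trans (proj₁ b)))))
                           (length-map length c)
      where
      Chn-trans = IsStrictTotalOrder.trans (lex-isStrictTotalOrder sto)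
      distinct : ∀ {c′} → c′ ⊆ c → AllPairs (_<ₗ_ _≺_) c′ → AllPairs (λ ρ ρ′ → length ρ ≢ length ρ′) c′
      distinct c′⊆ [] = []
      distinct c′⊆ (ρ< ∷ r) =
        All.tabulate (λ ρ′∈ e → Chn.≻⇒≢ (All.lookup ρ< ρ′∈)
                                   (sym (length-injective b (c′⊆ (here refl)) (c′⊆ (there ρ′∈)) e)))
          ∷ distinct (c′⊆ ∘ there) r

    lengths-⊆-range : lengths c ⊆ range
    lengths-⊆-range k∈ with ∈-lengths⁻ k∈
    ... | ρ , ρ∈ , refl = ∈-range⁺ (nonempty⇒length>0 (∈⇒nonempty b ρ∈)) (length≤ (∈⇒S b ρ∈))

    range⊆lengths⇒full : range ⊆ lengths c → length c ≡ suc d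
    range⊆lengths⇒full range⊆ =
      trans (sym length-lengths) (trans (cong length (Nat.⊆-antisym (lengths-sorted c) range-sorted lengths-⊆-range range⊆))
                                        (length-applyUpTo suc (suc d)))

    full⇒range⊆lengths : length c ≡ suc d → range ⊆ lengths c
    full⇒range⊆lengths l = subst (_ ⊆_) (sym lengths≡range) id
      where
      lengths≡range : lengths c ≡ range
      lengths≡range = Nat.⊆∧length≥⇒≡ (lengths-sorted c) range-sorted lengths-⊆-range
                        (≤-reflexive (trans (length-applyUpTo suc (suc d)) (trans (sym l) (sym length-lengths))))

    missing-length : length c ≡ d →
                     ∃[ k ] k ∈ range × k ∉ lengths c × (∀ {j} → j ∈ range → j ≢ k → j ∈ lengths c)
    missing-length l with Nat.length<⇒∃∉ (lengths-sorted c) range-sorted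
                            (≤-reflexive (trans (cong suc (trans length-lengths l)) (sym (length-applyUpTo suc (suc d)))))
    ... | k , k∈ , k∉ = k , k∈ , k∉ , others
      where
      range≡ : Nat.insert k (lengths c) ≡ range
      range≡ = Nat.insert-missing range-sorted k∈ (lengths-sorted c) lengths-⊆-range
                 (trans (cong suc (trans length-lengths l)) (sym (length-applyUpTo suc (suc d)))) k∉
      others : ∀ {j} → j ∈ range → j ≢ k → j ∈ lengths c
      others j∈ j≢k with Nat.∈-insert⁻ k (lengths c) (subst (_ ∈_) (sym range≡) j∈)
      ... | inj₁ j≡k = ⊥-elim (j≢k j≡k)
      ... | inj₂ j∈′ = j∈′

  top-below : ∀ {c} → BdS c → ∀ k → 0 < k →
              ∃[ lo ] S lo × length lo < k × (lo ≡ [] ⊎ lo ∈ c) × (∀ {ρ} → ρ ∈ c → length ρ < k → ρ ⊆ lo)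
  top-below {c} b k 0<k = lo , proj₁ lo-facts , proj₁ (proj₂ lo-facts) , proj₂ (proj₂ lo-facts) , below⊆
    where
    P? = λ (ρ : List V) → length ρ <? k
    lo = top (filter P? c)
    below⊆ : ∀ {ρ} → ρ ∈ c → length ρ < k → ρ ⊆ lo
    below⊆ ρ∈ lt = ⊆-top (filter-Bd P? b) (∈-filter⁺ P? ρ∈ lt)
    lo-facts : S lo × length lo < k × (lo ≡ [] ⊎ lo ∈ c)
    lo-facts with top-sel (filter P? c)
    ... | inj₁ lo≡[] rewrite lo≡[] = hasEmpty , 0<k , inj₁ refl
    ... | inj₂ lo∈ with ∈-filter⁻ P? {xs = c} lo∈
    ...   | lo∈c , lt = ∈⇒S b lo∈c , lt , inj₂ lo∈c

  ⊆-of-longer : ∀ {c lo σ} → BdS c → lo ≡ [] ⊎ lo ∈ c → Vtx.Sorted σ → (∀ {ρ} → ρ ∈ c → Comparable ρ σ) →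
                length lo ≤ length σ → lo ⊆ σ
  ⊆-of-longer b (inj₁ refl) sσ σ~ l = λ ()
  ⊆-of-longer b (inj₂ lo∈) sσ σ~ l = comparable⇒⊆ (∈⇒sorted b lo∈) sσ (σ~ lo∈) l

  module _ {c} (b : BdS c) {lo} (lo-in : lo ≡ [] ⊎ lo ∈ c) where

    bottom-above : ∀ {k} → k ≤ suc d → S lo → length lo < k →
                   ¬ ¬ (∃[ hi ] S hi × k ≤ length hi × lo ⊆ hi × (∀ {ρ} → ρ ∈ c → k < length ρ → hi ⊆ ρ))
    bottom-above {k} k≤ slo llo with filter (λ ρ → k <? length ρ) c in eq
    ... | [] = λ k′ → in-facet slo λ (τ , sτ , lτ , lo⊆τ) →
                 k′ (τ , sτ , subst (k ≤_) (sym lτ) k≤ , lo⊆τ , λ ρ∈ lt → ⊥-elim (no-above ρ∈ lt))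
      where
      no-above : ∀ {ρ} → ρ ∈ c → k < length ρ → ⊥
      no-above ρ∈ lt with subst (_ ∈_) eq (∈-filter⁺ (λ ρ → k <? length ρ) ρ∈ lt)
      ... | ()
    ... | ρ₀ ∷ rest = λ k′ → k′ (hi , ∈⇒S b hi∈c , <⇒≤ k<hi , lo⊆hi , above⊆)
      where
      P? = λ (ρ : List V) → k <? length ρ
      b′ : BdS (ρ₀ ∷ rest)
      b′ = subst BdS eq (filter-Bd P? b)
      hi = bottom (ρ₀ ∷ rest)
      hi∈ = ∈-filter⁻ P? {xs = c} (subst (hi ∈_) (sym eq) (bottom-∈ b′ (here refl)))
      hi∈c = proj₁ hi∈
      k<hi = proj₂ hi∈
      lo⊆hi : lo ⊆ hi
      lo⊆hi = ⊆-of-longer b lo-in (∈⇒sorted b hi∈c) (λ ρ∈ → ∈⇒comparable b ρ∈ hi∈c) (<⇒≤ (≤-trans llo (<⇒≤ k<hi)))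
      above⊆ : ∀ {ρ} → ρ ∈ c → k < length ρ → hi ⊆ ρ
      above⊆ ρ∈ lt = bottom-⊆ b′ (subst (_ ∈_) eq (∈-filter⁺ P? ρ∈ lt))

  fill-between : ∀ {c k lo hi} → BdS c → 0 < k → k ∉ lengths c → S lo → S hi → lo ⊆ hi → length lo ≤ k → k ≤ length hi →
                 (∀ {ρ} → ρ ∈ c → length ρ < k → ρ ⊆ lo) → (∀ {ρ} → ρ ∈ c → k < length ρ → hi ⊆ ρ) →
                 ∃[ γ ] γ ∉ c × BdS (Chn.insert γ c)
  fill-between {c} {k} b 0<k k∉ slo shi lo⊆hi llo lhi below⊆ above⊆
    with Vtx.⊆-interpolate (canonical slo) (canonical shi) lo⊆hi llo lhi
  ... | γ , sγ , lo⊆γ , γ⊆hi , lγ =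
    γ , (λ γ∈ → length≢k γ∈ lγ) , insert-Bd b (downClosed shi sγ γ⊆hi) (λ { refl → <-irrefl lγ 0<k }) γ~
    where
    length≢k : ∀ {ρ} → ρ ∈ c → length ρ ≢ k
    length≢k ρ∈ e = k∉ (subst (_∈ lengths c) e (∈-lengths⁺ ρ∈))
    γ~ : ∀ {ρ} → ρ ∈ c → Comparable ρ γ
    γ~ {ρ} ρ∈ with <-cmp (length ρ) k
    ... | tri< lt _ _ = inj₁ (⊆-trans (below⊆ ρ∈ lt) lo⊆γ)
    ... | tri≈ _ e _ = ⊥-elim (length≢k ρ∈ e)
    ... | tri> _ _ gt = inj₂ (⊆-trans γ⊆hi (above⊆ ρ∈ gt))

  fill-gap : ∀ {c k} → BdS c → k ∈ range → k ∉ lengths c → ¬ ¬ (∃[ γ ] γ ∉ c × BdS (Chn.insert γ c))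
  fill-gap {c} {k} b k∈ k∉ with ∈-range⁻ k∈
  ... | 0<k , k≤ with top-below b k 0<k
  ... | lo , slo , llo , lo-in , below⊆ = λ k′ → bottom-above b lo-in k≤ slo llo λ (hi , shi , lhi , lo⊆hi , above⊆) →
    k′ (fill-between b 0<k k∉ slo shi lo⊆hi (<⇒≤ llo) lhi below⊆ above⊆)

  Bd-pure : ∀ c → BdS c → Maximal (_<ₗ_ _≺_) BdS c → length c ≡ suc d
  Bd-pure c b maximal = range⊆lengths⇒full b present
    where
    present : range ⊆ lengths c
    present {k} k∈ with k Nat.∈? lengths c
    ... | yes k∈′ = k∈′
    ... | no k∉ = ⊥-elim (fill-gap b k∈ k∉ λ (γ , γ∉ , b′) →
                    γ∉ (subst (γ ∈_) (maximal _ b′ (Chn.∈-insert⁺ γ c)) (Chn.∈-insert-self γ c)))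

  Completion : Chain → ℕ → List V → Set
  Completion α k γ = S γ × length γ ≡ k × (∀ {ρ} → ρ ∈ α → Comparable ρ γ)

  TwoCompletions : Chain → ℕ → Set
  TwoCompletions α k = ∃[ γ₁ ] ∃[ γ₂ ] Completion α k γ₁ × Completion α k γ₂ × γ₁ ≢ γ₂ ×
                         (∀ {γ} → Completion α k γ → γ ≡ γ₁ ⊎ γ ≡ γ₂)

  module Completions {α} (b : BdS α) {k} (k∉ : k ∉ lengths α) {lo} (slo : S lo) (lo-in : lo ≡ [] ⊎ lo ∈ α)
                     (llo : suc (length lo) ≡ k) (below⊆ : ∀ {ρ} → ρ ∈ α → length ρ < k → ρ ⊆ lo) where

    below-or-above : ∀ {ρ} → ρ ∈ α → length ρ < k ⊎ k < length ρ
    below-or-above {ρ} ρ∈ with <-cmp (length ρ) k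
    ... | tri< lt _ _ = inj₁ lt
    ... | tri≈ _ e _ = ⊥-elim (k∉ (subst (_∈ lengths α) e (∈-lengths⁺ ρ∈)))
    ... | tri> _ _ gt = inj₂ gt

    lo⊆ : ∀ {γ} → Completion α k γ → lo ⊆ γ
    lo⊆ (sγ , lγ , γ~) = ⊆-of-longer b lo-in (canonical sγ) γ~ (≤-trans (n≤1+n _) (≤-reflexive (trans llo (sym lγ))))

    lo⊆longer : ∀ {σ} → σ ∈ α → k ≤ length σ → lo ⊆ σ
    lo⊆longer σ∈ l = ⊆-of-longer b lo-in (∈⇒sorted b σ∈) (λ ρ∈ → ∈⇒comparable b ρ∈ σ∈)
                       (≤-trans (n≤1+n _) (≤-trans (≤-reflexive llo) l))

    top-completions : k ≡ suc d → TwoCompletions α k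
    top-completions refl with thin lo slo (suc-injective llo)
    ... | β₁ , β₂ , (sβ₁ , lβ₁ , lo⊆β₁) , (sβ₂ , lβ₂ , lo⊆β₂) , β₁≢β₂ , unique =
      β₁ , β₂ , (sβ₁ , lβ₁ , ⊆β lo⊆β₁) , (sβ₂ , lβ₂ , ⊆β lo⊆β₂) , β₁≢β₂ ,
      λ {γ} γ-completion@(sγ , lγ , _) → unique γ sγ lγ (lo⊆ γ-completion)
      where
      ⊆β : ∀ {β} → lo ⊆ β → ∀ {ρ} → ρ ∈ α → Comparable ρ β
      ⊆β lo⊆β ρ∈ with below-or-above ρ∈
      ... | inj₁ lt = inj₁ (⊆-trans (below⊆ ρ∈ lt) lo⊆β)
      ... | inj₂ gt = ⊥-elim (<-irrefl refl (≤-trans gt (length≤ (∈⇒S b ρ∈))))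

    inner-completions : ∀ {hi} → hi ∈ α → length hi ≡ suc k → TwoCompletions α k
    inner-completions {hi} hi∈ lhi
      with Vtx.two-between (canonical slo) (∈⇒sorted b hi∈) (lo⊆longer hi∈ k≤hi) (trans lhi (cong suc (sym llo)))
      where
      k≤hi = ≤-trans (n≤1+n k) (≤-reflexive (sym lhi))
    ... | u , v , u≢v , u∉ , v∉ , u∈ , v∈ , between =
      Vtx.insert u lo , Vtx.insert v lo , completion u∉ u∈ , completion v∉ v∈ , u≢v ∘ Vtx.insert-injectiveˡ u∉ ,
      λ {γ} γ-completion@(sγ , lγ , γ~) →
        between (canonical sγ) (lo⊆ γ-completion) (⊆hi γ-completion) (trans lγ (sym llo))
      where
      ins⊆hi : ∀ {y} → y ∈ hi → Vtx.insert y lo ⊆ hi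
      ins⊆hi y∈ z∈ with Vtx.∈-insert⁻ _ lo z∈
      ... | inj₁ refl = y∈
      ... | inj₂ z∈lo = lo⊆longer hi∈ (≤-trans (n≤1+n k) (≤-reflexive (sym lhi))) z∈lo
      completion : ∀ {y} → y ∉ lo → y ∈ hi → Completion α k (Vtx.insert y lo)
      completion {y} y∉ y∈ = downClosed (∈⇒S b hi∈) (Vtx.insert-sorted y (canonical slo)) (ins⊆hi y∈) ,
                             trans (Vtx.length-insert y lo y∉) llo , γ~
        where
        γ~ : ∀ {ρ} → ρ ∈ α → Comparable ρ (Vtx.insert y lo)
        γ~ ρ∈ with below-or-above ρ∈
        ... | inj₁ lt = inj₁ (⊆-trans (below⊆ ρ∈ lt) (Vtx.∈-insert⁺ y lo))
        ... | inj₂ gt = inj₂ (⊆-trans (ins⊆hi y∈) (length≤⇒⊆ b hi∈ ρ∈ (≤-trans (≤-reflexive lhi) gt)))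
      ⊆hi : ∀ {γ} → Completion α k γ → γ ⊆ hi
      ⊆hi (sγ , lγ , γ~) with γ~ hi∈
      ... | inj₁ hi⊆γ = ⊥-elim (<-irrefl refl (≤-trans (≤-reflexive (sym lhi))
                          (≤-trans (Vtx.⊆⇒length≤ (∈⇒sorted b hi∈) (canonical sγ) hi⊆γ) (≤-reflexive lγ))))
      ... | inj₂ γ⊆hi = γ⊆hi

  two-completions : ∀ {α} → BdS α → length α ≡ d → ∃[ k ] k ∈ range × k ∉ lengths α × TwoCompletions α k
  two-completions {α} b l with missing-length b l
  ... | k , k∈ , k∉ , others with ∈-range⁻ k∈
  ... | 0<k , k≤ with top-below b k 0<k
  ... | lo , slo , llo , lo-in , below⊆ = k , k∈ , k∉ , completions
    where
    longer-than-shorter : ∀ j → suc j ≡ k → j ≤ length lo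
    longer-than-shorter zero _ = z≤n
    longer-than-shorter (suc j) refl with ∈-lengths⁻ (others (∈-range⁺ (s≤s z≤n) (≤-trans (n≤1+n _) k≤)) (1+n≢n ∘ sym))
    ... | ρ , ρ∈ , lρ =
      subst (_≤ length lo) lρ (Vtx.⊆⇒length≤ (∈⇒sorted b ρ∈) (canonical slo) (below⊆ ρ∈ (s≤s (≤-reflexive lρ))))
    length-lo : suc (length lo) ≡ k
    length-lo = tight llo longer-than-shorter
      where
      tight : ∀ {n m} → n < m → (∀ j → suc j ≡ m → j ≤ n) → suc n ≡ m
      tight {m = suc j} n<m below = ≤-antisym n<m (s≤s (below j refl))
    open Completions b k∉ slo lo-in length-lo below⊆
    completions : TwoCompletions α k
    completions with k ℕ.≟ suc d
    ... | yes k≡1+d = top-completions k≡1+d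
    ... | no k≢1+d with ∈-lengths⁻ (others (∈-range⁺ (s≤s z≤n) (≤∧≢⇒< k≤ k≢1+d)) 1+n≢n)
    ...   | hi , hi∈ , lhi = inner-completions hi∈ lhi

  Bd-thin : ∀ α → BdS α → length α ≡ d →
            ∃ λ β₁ → ∃ λ β₂ →
              (BdS β₁ × length β₁ ≡ suc d × α ⊆ β₁) ×
              (BdS β₂ × length β₂ ≡ suc d × α ⊆ β₂) ×
              β₁ ≢ β₂ ×
              (∀ β → BdS β → length β ≡ suc d → α ⊆ β → β ≡ β₁ ⊎ β ≡ β₂)
  Bd-thin α b l with two-completions b l
  ... | k , k∈ , k∉ , γ₁ , γ₂ , c₁ , c₂ , γ₁≢γ₂ , unique =
    Chn.insert γ₁ α , Chn.insert γ₂ α , extend c₁ , extend c₂ , distinct , only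
    where
    ∉α : ∀ {γ} → Completion α k γ → γ ∉ α
    ∉α (_ , lγ , _) γ∈ = k∉ (subst (_∈ lengths α) lγ (∈-lengths⁺ γ∈))
    extend : ∀ {γ} → Completion α k γ → BdS (Chn.insert γ α) × length (Chn.insert γ α) ≡ suc d × α ⊆ Chn.insert γ α
    extend {γ} c@(sγ , lγ , γ~) =
      insert-Bd b sγ (λ { refl → <-irrefl lγ (proj₁ (∈-range⁻ k∈)) }) γ~ ,
      trans (Chn.length-insert γ α (∉α c)) (cong suc l) , Chn.∈-insert⁺ γ α
    distinct : Chn.insert γ₁ α ≢ Chn.insert γ₂ α
    distinct e with Chn.∈-insert⁻ γ₂ α (subst (γ₁ ∈_) e (Chn.∈-insert-self γ₁ α))
    ... | inj₁ γ₁≡γ₂ = γ₁≢γ₂ γ₁≡γ₂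
    ... | inj₂ γ₁∈ = ∉α c₁ γ₁∈
    only : ∀ β → BdS β → length β ≡ suc d → α ⊆ β → β ≡ Chn.insert γ₁ α ⊎ β ≡ Chn.insert γ₂ α
    only β bβ lβ α⊆β with ∈-lengths⁻ (full⇒range⊆lengths bβ lβ k∈)
    ... | γ , γ∈ , lγ with unique (∈⇒S bβ γ∈ , lγ , λ ρ∈ → ∈⇒comparable bβ (α⊆β ρ∈) γ∈)
    ... | inj₁ refl = inj₁ (sym (Chn.insert-missing (proj₁ bβ) γ∈ (proj₁ b) α⊆β (trans (cong suc l) (sym lβ)) (∉α c₁)))
    ... | inj₂ refl = inj₂ (sym (Chn.insert-missing (proj₁ bβ) γ∈ (proj₁ b) α⊆β (trans (cong suc l) (sym lβ)) (∉α c₂)))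

  IsFlag : ℕ → List (List V) → Set
  IsFlag m F = (∀ {ρ} → ρ ∈ F → Vtx.Sorted ρ × ρ ≢ [] × length ρ ≤ m) ×
               (∀ {ρ ρ'} → ρ ∈ F → ρ' ∈ F → Comparable ρ ρ') ×
               (∀ {k} → 0 < k → k ≤ m → ∃[ ρ ] ρ ∈ F × length ρ ≡ k)

  ∷-isFlag : ∀ {n F σ} → IsFlag n F → Vtx.Sorted σ → length σ ≡ suc n → (∀ {ρ} → ρ ∈ F → ρ ⊆ σ) →
             IsFlag (suc n) (σ ∷ F)
  ∷-isFlag {n} {F} {σ} (el , cmp , has) sσ lσ ⊆σ = el′ , cmp′ , has′
    where
    el′ : ∀ {ρ} → ρ ∈ σ ∷ F → Vtx.Sorted ρ × ρ ≢ [] × length ρ ≤ suc n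
    el′ (here refl) = sσ , (λ { refl → 0≢1+n lσ }) , ≤-reflexive lσ
    el′ (there ρ∈) = let (sρ , ρ≢[] , lρ) = el ρ∈ in sρ , ρ≢[] , ≤-trans lρ (n≤1+n n)
    cmp′ : ∀ {ρ ρ'} → ρ ∈ σ ∷ F → ρ' ∈ σ ∷ F → Comparable ρ ρ'
    cmp′ (here refl) (here refl) = inj₁ id
    cmp′ (here refl) (there ρ'∈) = inj₂ (⊆σ ρ'∈)
    cmp′ (there ρ∈) (here refl) = inj₁ (⊆σ ρ∈)
    cmp′ (there ρ∈) (there ρ'∈) = cmp ρ∈ ρ'∈
    has′ : ∀ {k} → 0 < k → k ≤ suc n → ∃[ ρ ] ρ ∈ σ ∷ F × length ρ ≡ k
    has′ {k} 0<k k≤ with k ℕ.≟ suc n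
    ... | yes refl = σ , here refl , lσ
    ... | no k≢ = let (ρ , ρ∈ , lρ) = has 0<k (≤-pred (≤∧≢⇒< k≤ k≢)) in ρ , there ρ∈ , lρ

  suffixes-isFlag : ∀ {U m} → Vtx.Sorted U → length U ≡ m → IsFlag m (suffixes U)
  suffixes-isFlag {[]} _ refl = (λ ()) , (λ ()) , λ 0<k k≤0 → ⊥-elim (<-irrefl refl (≤-trans 0<k k≤0))
  suffixes-isFlag {x ∷ xs} s refl = ∷-isFlag (suffixes-isFlag (Linked.tail s) refl) s refl (λ ρ∈ z∈ → there (suffix-⊆ xs ρ∈ z∈))

  ∷-suffixes-isFlag : ∀ {σ α n} → Vtx.Sorted σ → Vtx.Sorted α → length σ ≡ suc n → length α ≡ n → α ⊆ σ →
                      IsFlag (suc n) (σ ∷ suffixes α)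
  ∷-suffixes-isFlag sσ sα lσ lα α⊆σ = ∷-isFlag (suffixes-isFlag sα lα) sσ lσ (λ ρ∈ → α⊆σ ∘ suffix-⊆ _ ρ∈)

  flag-full : ∀ {F} → IsFlag (suc d) F → (∀ {ρ} → ρ ∈ F → S ρ) → Full (Chn.fromList F)
  flag-full {F} (el , cmp , has) sF = b , range⊆lengths⇒full b present
    where
    b : BdS (Chn.fromList F)
    b = mkBd (Chn.fromList-sorted F) (λ ρ∈ → sF (Chn.∈-fromList⁻ F ρ∈) , proj₁ (proj₂ (el (Chn.∈-fromList⁻ F ρ∈))))
             (λ ρ∈ ρ'∈ → cmp (Chn.∈-fromList⁻ F ρ∈) (Chn.∈-fromList⁻ F ρ'∈))
    present : range ⊆ lengths (Chn.fromList F)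
    present k∈ with ∈-range⁻ k∈
    ... | 0<k , k≤ with has 0<k k≤
    ... | ρ , ρ∈ , refl = ∈-lengths⁺ (Chn.∈-fromList⁺ F ρ∈)

  AgreeAbove : ℕ → Chain → Chain → Set
  AgreeAbove m X Y = ∀ {ρ} → m < length ρ → (ρ ∈ X → ρ ∈ Y) × (ρ ∈ Y → ρ ∈ X)

  agree-sym : ∀ {m X Y} → AgreeAbove m X Y → AgreeAbove m Y X
  agree-sym agree lt = proj₂ (agree lt) , proj₁ (agree lt)

  agree-trans : ∀ {m X Y Z} → AgreeAbove m X Y → AgreeAbove m Y Z → AgreeAbove m X Z
  agree-trans XY YZ lt = proj₁ (YZ lt) ∘ proj₁ (XY lt) , proj₂ (XY lt) ∘ proj₂ (YZ lt)

  graftList : Chain → ℕ → List (List V) → List (List V)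
  graftList X m F = filter (λ ρ → m <? length ρ) X ++ F

  graft : Chain → ℕ → List (List V) → Chain
  graft X m F = Chn.fromList (graftList X m F)

  module _ {X : Chain} {m : ℕ} {F : List (List V)} where

    ∈-graft⁺ˡ : ∀ {ρ} → ρ ∈ X → m < length ρ → ρ ∈ graft X m F
    ∈-graft⁺ˡ ρ∈ lt = Chn.∈-fromList⁺ (graftList X m F) (∈-++⁺ˡ (∈-filter⁺ (λ ρ → m <? length ρ) ρ∈ lt))

    ∈-graft⁺ʳ : ∀ {ρ} → ρ ∈ F → ρ ∈ graft X m F
    ∈-graft⁺ʳ ρ∈ = Chn.∈-fromList⁺ (graftList X m F) (∈-++⁺ʳ (filter (λ ρ → m <? length ρ) X) ρ∈)

    ∈-graftList⁻ : ∀ {ρ} → ρ ∈ graftList X m F → (ρ ∈ X × m < length ρ) ⊎ ρ ∈ F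
    ∈-graftList⁻ ρ∈ with ∈-++⁻ (filter (λ ρ → m <? length ρ) X) ρ∈
    ... | inj₁ ρ∈X = inj₁ (∈-filter⁻ (λ ρ → m <? length ρ) {xs = X} ρ∈X)
    ... | inj₂ ρ∈F = inj₂ ρ∈F

    ∈-graft⁻ : ∀ {ρ} → ρ ∈ graft X m F → (ρ ∈ X × m < length ρ) ⊎ ρ ∈ F
    ∈-graft⁻ = ∈-graftList⁻ ∘ Chn.∈-fromList⁻ (graftList X m F)

  graft-∷ : ∀ X m σ F → graft X m (σ ∷ F) ≡ Chn.insert σ (graft X m F)
  graft-∷ X m σ F = Chn.⊆-antisym (Chn.fromList-sorted (graftList X m (σ ∷ F)))
                      (Chn.insert-sorted σ (Chn.fromList-sorted (graftList X m F))) ⊆ins ins⊆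
    where
    ⊆ins : graft X m (σ ∷ F) ⊆ Chn.insert σ (graft X m F)
    ⊆ins ρ∈ with ∈-graft⁻ {X} {m} {σ ∷ F} ρ∈
    ... | inj₁ (ρ∈X , lt) = Chn.∈-insert⁺ σ (graft X m F) (∈-graft⁺ˡ {X} {m} {F} ρ∈X lt)
    ... | inj₂ (here refl) = Chn.∈-insert-self σ (graft X m F)
    ... | inj₂ (there ρ∈F) = Chn.∈-insert⁺ σ (graft X m F) (∈-graft⁺ʳ {X} {m} {F} ρ∈F)
    ins⊆ : Chn.insert σ (graft X m F) ⊆ graft X m (σ ∷ F)
    ins⊆ ρ∈ with Chn.∈-insert⁻ σ (graft X m F) ρ∈
    ... | inj₁ refl = ∈-graft⁺ʳ {X} {m} {σ ∷ F} (here refl)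
    ... | inj₂ ρ∈′ with ∈-graft⁻ {X} {m} {F} ρ∈′
    ...   | inj₁ (ρ∈X , lt) = ∈-graft⁺ˡ {X} {m} {σ ∷ F} ρ∈X lt
    ...   | inj₂ ρ∈F = ∈-graft⁺ʳ {X} {m} {σ ∷ F} (there ρ∈F)

  graft-agrees : ∀ {X m F} → (∀ {σ} → σ ∈ F → length σ ≤ m) → AgreeAbove m X (graft X m F)
  graft-agrees {X} {m} {F} short {ρ} lt = (λ ρ∈ → ∈-graft⁺ˡ {X} {m} {F} ρ∈ lt) , from-graft
    where
    from-graft : ρ ∈ graft X m F → ρ ∈ X
    from-graft ρ∈ with ∈-graft⁻ {X} {m} {F} ρ∈
    ... | inj₁ (ρ∈X , _) = ρ∈X
    ... | inj₂ ρ∈F = ⊥-elim (<-irrefl refl (≤-trans lt (short ρ∈F)))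

  ∉-graft : ∀ {X m F σ} → (∀ {ρ} → ρ ∈ F → length ρ < m) → length σ ≡ m → σ ∉ graft X m F
  ∉-graft {X} {m} {F} shorter lσ σ∈ with ∈-graft⁻ {X} {m} {F} σ∈
  ... | inj₁ (_ , lt) = <-irrefl (sym lσ) lt
  ... | inj₂ σ∈F = <-irrefl lσ (shorter σ∈F)

  graft-full : ∀ {X W m F} → Full X → W ∈ X → length W ≤ suc m → IsFlag m F → (∀ {ρ} → ρ ∈ F → ρ ⊆ W) →
               Full (graft X m F)
  graft-full {X} {W} {m} {F} (bX , lX) W∈ lW (el , cmp , has) ⊆W = flag-full (el′ , cmp′ , has′) S′
    where
    L = graftList X m F
    W⊆ : ∀ {σ} → σ ∈ X → m < length σ → W ⊆ σ
    W⊆ σ∈ lt = length≤⇒⊆ bX W∈ σ∈ (≤-trans lW lt)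
    S′ : ∀ {ρ} → ρ ∈ L → S ρ
    S′ ρ∈ with ∈-graftList⁻ {X} {m} {F} ρ∈
    ... | inj₁ (ρ∈X , _) = ∈⇒S bX ρ∈X
    ... | inj₂ ρ∈F = downClosed (∈⇒S bX W∈) (proj₁ (el ρ∈F)) (⊆W ρ∈F)
    el′ : ∀ {ρ} → ρ ∈ L → Vtx.Sorted ρ × ρ ≢ [] × length ρ ≤ suc d
    el′ ρ∈ with ∈-graftList⁻ {X} {m} {F} ρ∈
    ... | inj₁ (ρ∈X , _) = ∈⇒sorted bX ρ∈X , ∈⇒nonempty bX ρ∈X , length≤ (∈⇒S bX ρ∈X)
    ... | inj₂ ρ∈F = proj₁ (el ρ∈F) , proj₁ (proj₂ (el ρ∈F)) , length≤ (S′ ρ∈)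
    cmp′ : ∀ {ρ ρ'} → ρ ∈ L → ρ' ∈ L → Comparable ρ ρ'
    cmp′ ρ∈ ρ'∈ with ∈-graftList⁻ {X} {m} {F} ρ∈ | ∈-graftList⁻ {X} {m} {F} ρ'∈
    ... | inj₁ (ρ∈X , _) | inj₁ (ρ'∈X , _) = ∈⇒comparable bX ρ∈X ρ'∈X
    ... | inj₁ (ρ∈X , lt) | inj₂ ρ'∈F = inj₂ (⊆-trans (⊆W ρ'∈F) (W⊆ ρ∈X lt))
    ... | inj₂ ρ∈F | inj₁ (ρ'∈X , lt) = inj₁ (⊆-trans (⊆W ρ∈F) (W⊆ ρ'∈X lt))
    ... | inj₂ ρ∈F | inj₂ ρ'∈F = cmp ρ∈F ρ'∈F
    has′ : ∀ {k} → 0 < k → k ≤ suc d → ∃[ ρ ] ρ ∈ L × length ρ ≡ k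
    has′ {k} 0<k k≤ with k ≤? m
    ... | yes k≤m = let (ρ , ρ∈ , lρ) = has 0<k k≤m in ρ , ∈-++⁺ʳ (filter (λ ρ → m <? length ρ) X) ρ∈ , lρ
    ... | no k≰m with ∈-lengths⁻ {X} (full⇒range⊆lengths bX lX (∈-range⁺ 0<k k≤))
    ...   | ρ , ρ∈ , lρ =
      ρ , ∈-++⁺ˡ {ys = F} (∈-filter⁺ (λ ρ → m <? length ρ) ρ∈ (subst (m <_) (sym lρ) (≰⇒> k≰m))) , lρ

  Path : Chain → Chain → Set
  Path = Star (Adjacent (_<ₗ_ _≺_) d BdS)

  insert-adjacent : ∀ {C σ σ'} → Chn.Sorted C → Full (Chn.insert σ C) → Full (Chn.insert σ' C) → σ ∉ C → σ' ∉ C →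
                    Adjacent (_<ₗ_ _≺_) d BdS (Chn.insert σ C) (Chn.insert σ' C)
  insert-adjacent {C} {σ} {σ'} sC (b , l) (b' , l') σ∉ σ'∉ =
    b , l , b' , l' , C , Bd-⊆ b sC (Chn.∈-insert⁺ σ C) , suc-injective (trans (sym (Chn.length-insert σ C σ∉)) l) ,
    Chn.∈-insert⁺ σ C , Chn.∈-insert⁺ σ' C

  agree-below : ∀ {X Y U m} → BdS X → BdS Y → U ∈ X → U ∈ Y → length U ≡ suc m → AgreeAbove (suc m) X Y → AgreeAbove m X Y
  agree-below {X} {Y} {U} {m} bX bY U∈X U∈Y lU agree {ρ} lt with suc m <? length ρ
  ... | yes gt = agree gt
  ... | no ≯ = (λ ρ∈X → subst (_∈ Y) (sym (at-U bX ρ∈X U∈X)) U∈Y) , (λ ρ∈Y → subst (_∈ X) (sym (at-U bY ρ∈Y U∈Y)) U∈X)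
    where
    at-U : ∀ {Z} → BdS Z → ρ ∈ Z → U ∈ Z → ρ ≡ U
    at-U bZ ρ∈ U∈ = length-injective bZ ρ∈ U∈ (trans (≤-antisym (≮⇒≥ ≯) lt) (sym lU))

  BelowSuffixes : List V → Chain → Set
  BelowSuffixes U Y = ∀ {ρ} → ρ ∈ Y → length ρ ≤ length U → ρ ∈ suffixes U

  ∈-of-belowSuffixes : ∀ {U Y} → Full Y → S U → U ≢ [] → BelowSuffixes U Y → U ∈ Y
  ∈-of-belowSuffixes {U} {Y} (bY , lY) sU U≢[] below
    with ∈-lengths⁻ (full⇒range⊆lengths bY lY (∈-range⁺ (nonempty⇒length>0 U≢[]) (length≤ sU)))
  ... | ψ , ψ∈ , lψ = subst (_∈ Y) (suffix-full-length U (below ψ∈ (≤-reflexive lψ)) lψ) ψ∈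

  -- Below U, first move X to the suffixes of its (n+1)-face φ, then exchange φ for the tail of U.
  path-to-suffixes : ∀ n {U X Y} → length U ≡ suc n → Full X → Full Y → U ∈ X →
                     AgreeAbove (suc n) X Y → BelowSuffixes U Y → Path X Y
  path-to-suffixes zero {U} {X} {Y} lU fX@(bX , _) fY@(bY , _) U∈X agree below =
    subst (Path X) (Chn.⊆-antisym (proj₁ bX) (proj₁ bY) X⊆Y Y⊆X) ε
    where
    U∈Y = ∈-of-belowSuffixes fY (∈⇒S bX U∈X) (∈⇒nonempty bX U∈X) below
    agree₀ = agree-below bX bY U∈X U∈Y lU agree
    X⊆Y : X ⊆ Y
    X⊆Y ρ∈ = proj₁ (agree₀ (nonempty⇒length>0 (∈⇒nonempty bX ρ∈))) ρ∈
    Y⊆X : Y ⊆ X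
    Y⊆X ρ∈ = proj₂ (agree₀ (nonempty⇒length>0 (∈⇒nonempty bY ρ∈))) ρ∈
  path-to-suffixes (suc n) {[]} () _ _ _ _ _
  path-to-suffixes (suc n) {u ∷ U′} {X} {Y} lU fX@(bX , lX) fY@(bY , _) U∈X agree below
    with ∈-lengths⁻ {X} (full⇒range⊆lengths bX lX
                           (∈-range⁺ (s≤s z≤n) (≤-trans (n≤1+n _) (≤-trans (≤-reflexive (sym lU)) (length≤ (∈⇒S bX U∈X))))))
  ... | [] , φ∈ , ()
  ... | y ∷ φ′ , φ∈ , lφ =
    path-to-suffixes n lφ fX fullA φ∈ (graft-agrees short-φ) belowA ◅◅
    (adjacentAB ◅ path-to-suffixes n lU′ fullB fY (∈-graft⁺ʳ {X} {suc n} {U′ ∷ suffixes φ′} (here refl)) agreeBY belowY)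
    where
    φ = y ∷ φ′
    lU′ = suc-injective lU
    lφ′ = suc-injective lφ
    sU = ∈⇒sorted bX U∈X
    sφ = ∈⇒sorted bX φ∈
    φ′⊆U′ : φ′ ⊆ U′
    φ′⊆U′ = Vtx.∷⊆∷⇒⊆ sU sφ (length≤⇒⊆ bX φ∈ U∈X (≤-trans (n≤1+n _) (≤-reflexive (trans (cong suc lφ) (sym lU)))))
    short-φ′ : ∀ {σ} → σ ∈ suffixes φ′ → length σ < suc n
    short-φ′ σ∈ = s≤s (≤-trans (suffix-length≤ φ′ σ∈) (≤-reflexive lφ′))
    short-φ : ∀ {σ} → σ ∈ suffixes φ → length σ ≤ suc n
    short-φ (here refl) = ≤-reflexive lφ
    short-φ (there σ∈) = <⇒≤ (short-φ′ σ∈)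
    short-U′ : ∀ {σ} → σ ∈ U′ ∷ suffixes φ′ → length σ ≤ suc n
    short-U′ (here refl) = ≤-reflexive lU′
    short-U′ (there σ∈) = <⇒≤ (short-φ′ σ∈)
    A = graft X (suc n) (suffixes φ)
    B = graft X (suc n) (U′ ∷ suffixes φ′)
    fullA : Full A
    fullA = graft-full fX φ∈ (≤-trans (≤-reflexive lφ) (n≤1+n _)) (suffixes-isFlag sφ lφ) (suffix-⊆ φ)
    fullB : Full B
    fullB = graft-full fX U∈X (≤-reflexive lU) (∷-suffixes-isFlag (Linked.tail sU) (Linked.tail sφ) lU′ lφ′ φ′⊆U′) ⊆U
      where
      ⊆U : ∀ {ρ} → ρ ∈ U′ ∷ suffixes φ′ → ρ ⊆ u ∷ U′
      ⊆U (here refl) = there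
      ⊆U (there ρ∈) = there ∘ φ′⊆U′ ∘ suffix-⊆ φ′ ρ∈
    adjacentAB : Adjacent (_<ₗ_ _≺_) d BdS A B
    adjacentAB rewrite graft-∷ X (suc n) φ (suffixes φ′) | graft-∷ X (suc n) U′ (suffixes φ′) =
      insert-adjacent (Chn.fromList-sorted (graftList X (suc n) (suffixes φ′)))
        (subst Full (graft-∷ X (suc n) φ (suffixes φ′)) fullA) (subst Full (graft-∷ X (suc n) U′ (suffixes φ′)) fullB)
        (∉-graft {X} short-φ′ lφ) (∉-graft {X} short-φ′ lU′)
    belowA : BelowSuffixes φ A
    belowA ρ∈ l with ∈-graft⁻ {X} {suc n} {suffixes φ} ρ∈
    ... | inj₁ (_ , lt) = ⊥-elim (<-irrefl refl (≤-trans lt (≤-trans l (≤-reflexive lφ))))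
    ... | inj₂ ρ∈F = ρ∈F
    agreeBY : AgreeAbove (suc n) B Y
    agreeBY = agree-trans (agree-sym (graft-agrees short-U′))
                (agree-below bX bY U∈X (∈-of-belowSuffixes fY (∈⇒S bX U∈X) (λ ()) below) lU agree)
    belowY : BelowSuffixes U′ Y
    belowY ρ∈ l with below ρ∈ (≤-trans l (n≤1+n _))
    ... | here refl = ⊥-elim (<-irrefl refl l)
    ... | there ρ∈′ = ρ∈′

  ∷-suffixes-full : ∀ {T α} → S T → length T ≡ suc d → S α → α ⊆ T → length α ≡ d → Full (Chn.fromList (T ∷ suffixes α))
  ∷-suffixes-full {T} {α} sT lT sα α⊆T lα = flag-full (∷-suffixes-isFlag (canonical sT) (canonical sα) lT lα α⊆T) S-member
    where
    S-member : ∀ {ρ} → ρ ∈ T ∷ suffixes α → S ρ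
    S-member (here refl) = sT
    S-member (there ρ∈) = suffix-S sα ρ∈

  suffixFlag-full : ∀ {T} → S T → length T ≡ suc d → Full (suffixFlag T)
  suffixFlag-full {T} sT lT = flag-full (suffixes-isFlag (canonical sT) lT) (suffix-S sT)

  path-to-suffixFlag : ∀ {X T} → Full X → T ∈ X → length T ≡ suc d → Path X (suffixFlag T)
  path-to-suffixFlag {X} {T} fX@(bX , _) T∈ lT =
    path-to-suffixes d lT fX (suffixFlag-full (∈⇒S bX T∈) lT) T∈ nothing-above (λ ρ∈ _ → Chn.∈-fromList⁻ (suffixes T) ρ∈)
    where
    nothing-above : AgreeAbove (suc d) X (suffixFlag T)
    nothing-above {ρ} lt =
      (λ ρ∈ → ⊥-elim (<-irrefl refl (≤-trans lt (length≤ (∈⇒S bX ρ∈))))) ,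
      (λ ρ∈ → ⊥-elim (<-irrefl refl
                 (≤-trans lt (≤-trans (suffix-length≤ T (Chn.∈-fromList⁻ (suffixes T) ρ∈)) (≤-reflexive lT)))))

  Adjacent-sym : ∀ {X Y} → Adjacent (_<ₗ_ _≺_) d BdS X Y → Adjacent (_<ₗ_ _≺_) d BdS Y X
  Adjacent-sym (bX , lX , bY , lY , C , bC , lC , C⊆X , C⊆Y) = bY , lY , bX , lX , C , bC , lC , C⊆Y , C⊆X

  adjacent-suffixFlags : ∀ {T T'} → Adjacent _≺_ d S T T' → Path (suffixFlag T) (suffixFlag T')
  adjacent-suffixFlags {T} {T'} (sT , lT , sT' , lT' , α , sα , lα , α⊆T , α⊆T') =
    Star.reverse Adjacent-sym (path-to-suffixFlag fZ (Chn.∈-insert-self T (suffixFlag α)) lT) ◅◅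
    (insert-adjacent (Chn.fromList-sorted (suffixes α)) fZ fZ' (∉ lT) (∉ lT') ◅
     path-to-suffixFlag fZ' (Chn.∈-insert-self T' (suffixFlag α)) lT')
    where
    fZ = ∷-suffixes-full sT lT sα α⊆T lα
    fZ' = ∷-suffixes-full sT' lT' sα α⊆T' lα
    ∉ : ∀ {σ} → length σ ≡ suc d → σ ∉ suffixFlag α
    ∉ lσ σ∈ = <-irrefl refl (≤-trans (≤-reflexive (sym lσ))
                (≤-trans (suffix-length≤ α (Chn.∈-fromList⁻ (suffixes α) σ∈)) (≤-reflexive lα)))

  Bd-connected : ∀ β β' → BdS β → length β ≡ suc d → BdS β' → length β' ≡ suc d → Path β β'
  Bd-connected β β' b l b' l' with facet b l | facet b' l'
    where
    facet : ∀ {X} → BdS X → length X ≡ suc d → ∃[ T ] T ∈ X × length T ≡ suc d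
    facet {X} bX lX = ∈-lengths⁻ {X} (full⇒range⊆lengths bX lX (∈-range⁺ (s≤s z≤n) ≤-refl))
  ... | T , T∈ , lT | T' , T'∈ , lT' =
    path-to-suffixFlag (b , l) T∈ lT ◅◅
    kleisliStar suffixFlag adjacent-suffixFlags (connected T T' (∈⇒S b T∈) lT (∈⇒S b' T'∈) lT') ◅◅
    Star.reverse Adjacent-sym (path-to-suffixFlag (b' , l') T'∈ lT')

  Bd-isPseudomanifold : IsPseudomanifold (_<ₗ_ _≺_) d BdS
  Bd-isPseudomanifold = record
    { complex = Bd-isComplex
    ; pure = Bd-pure
    ; thin = Bd-thin
    ; connected = Bd-connected
    }

module DVF {V : Set} {_≺_ : Rel V 0ℓ} (sto : IsStrictTotalOrder _≡_ _≺_) {S : List V → Set} (K : IsComplex _≺_ S)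
           {W : List V → List V → Set} (dvf : IsDVF _≺_ S W) where

  open Chains sto K public
  open IsDVF dvf

  W-⊆ : ∀ {α β} → W α β → α ⊆ β
  W-⊆ p = proj₁ (proj₂ (proj₂ (pairsInK p)))

  W-length : ∀ {α β} → W α β → suc (length α) ≡ length β
  W-length p = proj₂ (proj₂ (proj₂ (pairsInK p)))

  W-S-lower : ∀ {α β} → W α β → S α
  W-S-lower p = proj₁ (pairsInK p)

  W-S-upper : ∀ {α β} → W α β → S β
  W-S-upper p = proj₁ (proj₂ (pairsInK p))

  W-upper-unique : ∀ {α β β'} → W α β → W α β' → β ≡ β'
  W-upper-unique p q = proj₂ (atMostOnce p q (inj₁ refl))

  W-lower-unique : ∀ {α α' β} → W α β → W α' β → α ≡ α'
  W-lower-unique p q = proj₁ (atMostOnce p q (inj₂ (inj₂ (inj₂ refl))))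

  W-lower≢upper : ∀ {α β γ} → W α β → W β γ → ⊥
  W-lower≢upper p q = <-irrefl (cong length (proj₁ (atMostOnce p q (inj₂ (inj₂ (inj₁ refl)))))) (≤-reflexive (W-length p))

  W-upper≢[] : ∀ {α β} → W α β → β ≢ []
  W-upper≢[] p refl with W-length p
  ... | ()

  W-vertex : ∀ {α β} → W α β → ∃[ x ] x ∉ α × Vtx.insert x α ≡ β
  W-vertex p = Vtx.⊆∧length≡suc⇒insert (canonical (W-S-lower p)) (canonical (W-S-upper p)) (W-⊆ p) (W-length p)

  critical-not-lower : ∀ {σ β} → Critical _≺_ S W σ → W σ β → ⊥
  critical-not-lower {σ} {β} (_ , _ , inj₁ unpaired) p = proj₁ (unpaired σ β p) refl
  critical-not-lower (_ , _ , inj₂ (_ , q)) p = W-lower≢upper q p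

  critical-lower≡[] : ∀ {σ α} → Critical _≺_ S W σ → W α σ → α ≡ []
  critical-lower≡[] {σ} {α} (_ , _ , inj₁ unpaired) p = ⊥-elim (proj₂ (unpaired α σ p) refl)
  critical-lower≡[] (_ , _ , inj₂ (_ , q)) p = W-lower-unique p q

module BdField {V : Set} {_≺_ : Rel V 0ℓ} (sto : IsStrictTotalOrder _≡_ _≺_) {S : List V → Set} (K : IsComplex _≺_ S)
               {W : List V → List V → Set} (dvf : IsDVF _≺_ S W) {t : List V} (t-critical : Critical _≺_ S W t) where

  open DVF sto K dvf public

  without? : (x : V) → Decidable (λ ρ → x ∉ ρ)
  without? x ρ = ¬? (x Vtx.∈? ρ)

  apex : V → Chain → List V
  apex x a = Vtx.insert x (top (filter (without? x) a))

  x∈apex : ∀ x a → x ∈ apex x a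
  x∈apex x a = Vtx.∈-insert-self x (top (filter (without? x) a))

  module Apex {a} (b : BdS a) (x : V) where

    private
      τ = top (filter (without? x) a)
      b′ = filter-Bd (without? x) b

    ⊆-apex : ∀ {ρ} → ρ ∈ a → x ∉ ρ → ρ ⊆ apex x a
    ⊆-apex ρ∈ x∉ρ = Vtx.∈-insert⁺ x τ ∘ ⊆-top b′ (∈-filter⁺ (without? x) ρ∈ x∉ρ)

    base : τ ≡ [] ⊎ τ ∈ a × x ∉ τ
    base with top-sel (filter (without? x) a)
    ... | inj₁ τ≡[] = inj₁ τ≡[]
    ... | inj₂ τ∈ = inj₂ (∈-filter⁻ (without? x) {xs = a} τ∈)

    base-sorted : Vtx.Sorted τ
    base-sorted with base
    ... | inj₁ τ≡[] = subst Vtx.Sorted (sym τ≡[]) []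
    ... | inj₂ (τ∈ , _) = ∈⇒sorted b τ∈

    apex-sorted : Vtx.Sorted (apex x a)
    apex-sorted = Vtx.insert-sorted x base-sorted

    base⊆ : ∀ {ρ} → ρ ∈ a → x ∈ ρ → τ ⊆ ρ
    base⊆ ρ∈ x∈ρ with base
    ... | inj₁ τ≡[] = subst (_⊆ _) (sym τ≡[]) (λ ())
    ... | inj₂ (τ∈ , x∉τ) with ∈⇒comparable b τ∈ ρ∈
    ...   | inj₁ τ⊆ρ = τ⊆ρ
    ...   | inj₂ ρ⊆τ = ⊥-elim (x∉τ (ρ⊆τ x∈ρ))

    apex-⊆ : ∀ {ρ} → ρ ∈ a → x ∈ ρ → apex x a ⊆ ρ
    apex-⊆ ρ∈ x∈ρ z∈ with Vtx.∈-insert⁻ x τ z∈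
    ... | inj₁ refl = x∈ρ
    ... | inj₂ z∈τ = base⊆ ρ∈ x∈ρ z∈τ

    apex-comparable : ∀ {ρ} → ρ ∈ a → Comparable ρ (apex x a)
    apex-comparable {ρ} ρ∈ with x Vtx.∈? ρ
    ... | yes x∈ρ = inj₂ (apex-⊆ ρ∈ x∈ρ)
    ... | no x∉ρ = inj₁ (⊆-apex ρ∈ x∉ρ)

    apex-S : ∀ {p} → p ∈ a → x ∈ p → S (apex x a)
    apex-S p∈ x∈p = downClosed (∈⇒S b p∈) apex-sorted (apex-⊆ p∈ x∈p)

    insert-apex-Bd : ∀ {p} → p ∈ a → x ∈ p → BdS (Chn.insert (apex x a) a)
    insert-apex-Bd p∈ x∈p = insert-Bd b (apex-S p∈ x∈p) (λ e → ¬Any[] (subst (x ∈_) e (x∈apex x a))) apex-comparable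

    x∉base : x ∉ τ
    x∉base x∈τ with base
    ... | inj₁ τ≡[] = ¬Any[] (subst (x ∈_) τ≡[] x∈τ)
    ... | inj₂ (_ , x∉τ) = x∉τ x∈τ

    apex-shorter : ∀ {p φ} → p ∈ a → Vtx.Sorted φ → x ∉ φ → Vtx.insert x φ ≡ p → φ ∉ a → φ ≢ [] →
                   length (apex x a) < length p
    apex-shorter {p} {φ} p∈ sφ x∉φ refl φ∉ φ≢[] =
      subst₂ _<_ (sym (Vtx.length-insert x τ x∉base)) (sym (Vtx.length-insert x φ x∉φ))
        (s≤s (Vtx.⊆∧≢⇒length< base-sorted sφ τ⊆φ τ≢φ))
      where
      τ⊆φ : τ ⊆ φ
      τ⊆φ z∈ with Vtx.∈-insert⁻ x φ (base⊆ p∈ (Vtx.∈-insert-self x φ) z∈)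
      ... | inj₁ refl = ⊥-elim (x∉base z∈)
      ... | inj₂ z∈φ = z∈φ
      τ≢φ : τ ≢ φ
      τ≢φ τ≡φ with base
      ... | inj₁ τ≡[] = φ≢[] (trans (sym τ≡φ) τ≡[])
      ... | inj₂ (τ∈ , _) = φ∉ (subst (_∈ a) τ≡φ τ∈)

  apex-insert : ∀ {x σ} a → x ∈ σ → apex x (Chn.insert σ a) ≡ apex x a
  apex-insert {x} {σ} a x∈σ = cong (Vtx.insert x ∘ top) (Chn.filter-insert (without? x) a (λ x∉σ → x∉σ x∈σ))

  lowestPresent : Chain → List V → List V
  lowestPresent a [] = []
  lowestPresent a (y ∷ ys) with ys Chn.∈? a
  ... | yes _ = lowestPresent a ys
  ... | no _ = y ∷ ys

  IsLowestPresent : Chain → List V → V → List V → Set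
  IsLowestPresent a U x φ = (x ∷ φ) ∈ suffixes U × φ ∉ a × (∀ {ρ} → ρ ∈ suffixes U → length φ < length ρ → ρ ∈ a)

  lowestPresent-spec : ∀ {a U} → BdS a → U ∈ a → ∃[ x ] ∃[ φ ] lowestPresent a U ≡ x ∷ φ × IsLowestPresent a U x φ
  lowestPresent-spec {a} {[]} b U∈ = ⊥-elim (∈⇒nonempty b U∈ refl)
  lowestPresent-spec {a} {y ∷ ys} b U∈ with ys Chn.∈? a
  ... | no ys∉ = y , ys , refl , here refl , ys∉ , above
    where
    above : ∀ {ρ} → ρ ∈ suffixes (y ∷ ys) → length ys < length ρ → ρ ∈ a
    above (here refl) _ = U∈
    above (there ρ∈) lt = ⊥-elim (<-irrefl refl (≤-trans lt (suffix-length≤ ys ρ∈)))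
  ... | yes ys∈ with lowestPresent-spec b ys∈
  ...   | x , φ , e , x∷φ∈ , φ∉ , above = x , φ , e , there x∷φ∈ , φ∉ , above′
    where
    above′ : ∀ {ρ} → ρ ∈ suffixes (y ∷ ys) → length φ < length ρ → ρ ∈ a
    above′ (here refl) _ = U∈
    above′ (there ρ∈) lt = above ρ∈ lt

  lowestPresent-unique : ∀ {a U x φ} → IsLowestPresent a U x φ → lowestPresent a U ≡ x ∷ φ
  lowestPresent-unique {a} {y ∷ ys} (x∷φ∈ , φ∉ , above) with ys Chn.∈? a | x∷φ∈
  ... | yes ys∈ | here refl = ⊥-elim (φ∉ ys∈)
  ... | yes ys∈ | there x∷φ∈′ = lowestPresent-unique (x∷φ∈′ , φ∉ , above ∘ there)
  ... | no ys∉ | here refl = refl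
  ... | no ys∉ | there x∷φ∈′ = ⊥-elim (ys∉ (above (there (self x∷φ∈′)) (suffix-length≤ ys x∷φ∈′)))
    where
    self : ∀ {zs ρ : List V} → ρ ∈ suffixes zs → zs ∈ suffixes zs
    self {_ ∷ _} _ = here refl

  ConeStep : V → Chain → Chain → Set
  ConeStep x a c = apex x a ∉ a × c ≡ Chn.insert (apex x a) a

  LiftTop : Chain → Chain → Set
  LiftTop a c = ∃[ α ] ∃[ β ] W α β × α ≢ [] × top a ≡ α × c ≡ Chn.insert β a

  ConeOverPair : Chain → Chain → Set
  ConeOverPair a c = ∃[ α ] ∃[ β ] W α β × α ≢ [] × top a ≡ β × α ∉ a ×
                       ∃[ x ] x ∉ α × Vtx.insert x α ≡ β × ConeStep x a c

  ConeOverCritical : Chain → Chain → Set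
  ConeOverCritical a c = top a ≡ t × ∃[ x ] ∃[ φ ] lowestPresent a t ≡ x ∷ φ × ConeStep x a c

  BdW : Chain → Chain → Set
  BdW a c = BdS a × (LiftTop a c ⊎ ConeOverPair a c ⊎ ConeOverCritical a c)

  apex-of-cone : ∀ {x a c} → ConeStep x a c → apex x c ≡ apex x a
  apex-of-cone {x} {a} (_ , refl) = apex-insert a (x∈apex x a)

  cone-injective : ∀ {x a a' c} → BdS a → BdS a' → ConeStep x a c → ConeStep x a' c → a ≡ a'
  cone-injective {x} {a} {a'} {c} b b' step@(f∉a , c≡) step'@(f'∉a' , c≡') =
    Chn.insert-injectiveʳ (proj₁ b) (proj₁ b') f∉a (subst (_∉ a') (sym same-apex) f'∉a')
      (trans (sym c≡) (trans c≡' (cong (λ f → Chn.insert f a') (sym same-apex))))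
    where
    same-apex : apex x a ≡ apex x a'
    same-apex = trans (sym (apex-of-cone step)) (apex-of-cone step')

  cone-not-twice : ∀ {x a c e} → ConeStep x a c → ConeStep x c e → ⊥
  cone-not-twice {x} {a} step@(_ , refl) (f∉c , _) =
    f∉c (subst (_∈ Chn.insert (apex x a) a) (sym (apex-of-cone step)) (Chn.∈-insert-self (apex x a) a))

  t≢[] : t ≢ []
  t≢[] = proj₁ (proj₂ t-critical)

  top≡t⇒t∈ : ∀ {c} → BdS c → top c ≡ t → t ∈ c
  top≡t⇒t∈ b top≡t = top≡⇒∈ b top≡t t≢[]

  lowestPresent-at : ∀ {a x φ} → BdS a → top a ≡ t → lowestPresent a t ≡ x ∷ φ → IsLowestPresent a t x φ
  lowestPresent-at b top≡t e with lowestPresent-spec b (top≡t⇒t∈ b top≡t)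
  ... | _ , _ , e′ , spec with trans (sym e′) e
  ... | refl = spec

  module _ {a} (b : BdS a) where

    lift-facts : ∀ {α β} → W α β → α ≢ [] → top a ≡ α → β ∉ a × BdS (Chn.insert β a) × top (Chn.insert β a) ≡ β
    lift-facts {α} {β} p α≢[] top≡α = β∉ , b′ , top-unique b′ (Chn.∈-insert-self β a) ⊆β
      where
      ⊆α : ∀ {ρ} → ρ ∈ a → ρ ⊆ α
      ⊆α ρ∈ = subst (_ ⊆_) top≡α (⊆-top b ρ∈)
      β∉ : β ∉ a
      β∉ β∈ = <-irrefl refl (≤-trans (≤-reflexive (W-length p))
                               (Vtx.⊆⇒length≤ (canonical (W-S-upper p)) (canonical (W-S-lower p)) (⊆α β∈)))
      b′ : BdS (Chn.insert β a)
      b′ = insert-Bd b (W-S-upper p) (W-upper≢[] p) (λ ρ∈ → inj₁ (⊆-trans (⊆α ρ∈) (W-⊆ p)))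
      ⊆β : ∀ {ρ} → ρ ∈ Chn.insert β a → ρ ⊆ β
      ⊆β ρ∈ with Chn.∈-insert⁻ β a ρ∈
      ... | inj₁ refl = id
      ... | inj₂ ρ∈a = ⊆-trans (⊆α ρ∈a) (W-⊆ p)

    cone-facts : ∀ {x c} → top a ≢ [] → x ∈ top a → ConeStep x a c → IsFacet (_<ₗ_ _≺_) a c × BdS c × top c ≡ top a
    cone-facts {x} {c} top≢[] x∈ (f∉ , refl) = insert-isFacet f∉ , b′ , top-unique b′ (Chn.∈-insert⁺ (apex x a) a T∈) ⊆T
      where
      T∈ = top≢[]⇒top∈ b top≢[]
      b′ = Apex.insert-apex-Bd b x T∈ x∈
      ⊆T : ∀ {ρ} → ρ ∈ Chn.insert (apex x a) a → ρ ⊆ top a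
      ⊆T ρ∈ with Chn.∈-insert⁻ (apex x a) a ρ∈
      ... | inj₁ refl = Apex.apex-⊆ b x T∈ x∈
      ... | inj₂ ρ∈a = ⊆-top b ρ∈a

    pair-cone-facts : ∀ {c} → ConeOverPair a c → IsFacet (_<ₗ_ _≺_) a c × BdS c × top c ≡ top a
    pair-cone-facts (α , β , p , _ , top≡β , _ , x , _ , refl , step) =
      cone-facts (λ e → W-upper≢[] p (trans (sym top≡β) e)) (subst (x ∈_) (sym top≡β) (Vtx.∈-insert-self x α)) step

    critical-cone-facts : ∀ {c} → ConeOverCritical a c → IsFacet (_<ₗ_ _≺_) a c × BdS c × top c ≡ top a
    critical-cone-facts (top≡t , x , φ , e , step) =
      cone-facts (t≢[] ∘ trans (sym top≡t)) (subst (x ∈_) (sym top≡t) x∈t) step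
      where
      x∈t : x ∈ t
      x∈t = suffix-⊆ t (proj₁ (lowestPresent-at b top≡t e)) (here refl)

  t-not-lower : ∀ {β} → W t β → ⊥
  t-not-lower = critical-not-lower t-critical

  t-not-upper : ∀ {α} → W α t → α ≢ [] → ⊥
  t-not-upper p α≢[] = α≢[] (critical-lower≡[] t-critical p)

  cone-keeps-lowestPresent : ∀ {a c x φ} → BdS a → top a ≡ t → lowestPresent a t ≡ x ∷ φ → ConeStep x a c →
                         lowestPresent c t ≡ x ∷ φ
  cone-keeps-lowestPresent {a} {c} {x} {φ} b top≡t e (f∉ , refl) =
    lowestPresent-unique (x∷φ∈ , φ∉c , λ ρ∈ lt → Chn.∈-insert⁺ (apex x a) a (above ρ∈ lt))
    where
    spec = lowestPresent-at b top≡t e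
    x∷φ∈ = proj₁ spec
    above = proj₂ (proj₂ spec)
    x∉φ : x ∉ φ
    x∉φ = Vtx.head∉tail (Vtx.suffix-sorted (canonical (proj₁ t-critical)) x∷φ∈)
    φ∉c : φ ∉ Chn.insert (apex x a) a
    φ∉c φ∈ with Chn.∈-insert⁻ (apex x a) a φ∈
    ... | inj₁ refl = x∉φ (x∈apex x a)
    ... | inj₂ φ∈a = proj₁ (proj₂ spec) φ∈a

  module _ {a} (b : BdS a) where

    lift-upper : ∀ {c} → LiftTop a c → ∃[ α ] W α (top c) × α ≢ [] × α ∈ c
    lift-upper (α , β , p , α≢[] , top≡α , refl) =
      α , subst (W α) (sym (proj₂ (proj₂ (lift-facts b p α≢[] top≡α)))) p , α≢[] ,
      Chn.∈-insert⁺ β a (top≡⇒∈ b top≡α α≢[])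

    pair-upper : ∀ {c} → ConeOverPair a c → ∃[ α ] W α (top c) × α ≢ [] × α ∉ c
    pair-upper {c} pc@(α , β , p , α≢[] , top≡β , α∉ , x , x∉α , refl , step@(_ , refl)) =
      α , subst (W α) (sym (trans (proj₂ (proj₂ (pair-cone-facts b pc))) top≡β)) p , α≢[] , α∉c
      where
      α∉c : α ∉ c
      α∉c α∈ with Chn.∈-insert⁻ (apex x a) a α∈
      ... | inj₁ refl = x∉α (x∈apex x a)
      ... | inj₂ α∈a = α∉ α∈a

    critical-upper : ∀ {c} → ConeOverCritical a c → top c ≡ t
    critical-upper cc@(top≡t , _) = trans (proj₂ (proj₂ (critical-cone-facts b cc))) top≡t

  BdW-facet : ∀ {a c} → BdW a c → BdS a × BdS c × IsFacet (_<ₗ_ _≺_) a c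
  BdW-facet (b , inj₁ (α , β , p , α≢[] , top≡α , refl)) =
    b , proj₁ (proj₂ (lift-facts b p α≢[] top≡α)) , insert-isFacet (proj₁ (lift-facts b p α≢[] top≡α))
  BdW-facet (b , inj₂ (inj₁ pc)) = b , proj₁ (proj₂ (pair-cone-facts b pc)) , proj₁ (pair-cone-facts b pc)
  BdW-facet (b , inj₂ (inj₂ cc)) = b , proj₁ (proj₂ (critical-cone-facts b cc)) , proj₁ (critical-cone-facts b cc)

  same-lower : ∀ {a c c'} → BdW a c → BdW a c' → c ≡ c'
  same-lower {a} (b , inj₁ (α , β , p , _ , top≡α , refl)) (_ , inj₁ (α' , β' , p' , _ , top≡α' , refl))
    with trans (sym top≡α) top≡α'
  ... | refl = cong (λ β → Chn.insert β a) (W-upper-unique p p')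
  same-lower (_ , inj₁ (α , β , p , _ , top≡α , _)) (_ , inj₂ (inj₁ (α' , β' , p' , _ , top≡β' , _))) =
    ⊥-elim (W-lower≢upper p' (subst (λ σ → W σ β) (trans (sym top≡α) top≡β') p))
  same-lower (_ , inj₁ (α , β , p , _ , top≡α , _)) (_ , inj₂ (inj₂ (top≡t , _))) =
    ⊥-elim (t-not-lower (subst (λ σ → W σ β) (trans (sym top≡α) top≡t) p))
  same-lower (_ , inj₂ (inj₁ (α , β , p , _ , top≡β , _))) (_ , inj₁ (α' , β' , p' , _ , top≡α' , _)) =
    ⊥-elim (W-lower≢upper p (subst (λ σ → W σ β') (trans (sym top≡α') top≡β) p'))
  same-lower (_ , inj₂ (inj₁ (α , β , p , _ , top≡β , _ , x , x∉ , ins , (_ , refl))))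
             (_ , inj₂ (inj₁ (α' , β' , p' , _ , top≡β' , _ , x' , _ , ins' , (_ , refl))))
    with trans (sym top≡β) top≡β'
  ... | refl with W-lower-unique p p'
  ...   | refl with Vtx.insert-injectiveˡ x∉ (trans ins (sym ins'))
  ...     | refl = refl
  same-lower (_ , inj₂ (inj₁ (α , β , p , α≢[] , top≡β , _))) (_ , inj₂ (inj₂ (top≡t , _))) =
    ⊥-elim (t-not-upper (subst (W α) (trans (sym top≡β) top≡t) p) α≢[])
  same-lower (_ , inj₂ (inj₂ (top≡t , _))) (_ , inj₁ (α' , β' , p' , _ , top≡α' , _)) =
    ⊥-elim (t-not-lower (subst (λ σ → W σ β') (trans (sym top≡α') top≡t) p'))
  same-lower (_ , inj₂ (inj₂ (top≡t , _))) (_ , inj₂ (inj₁ (α' , β' , p' , α'≢[] , top≡β' , _))) =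
    ⊥-elim (t-not-upper (subst (W α') (trans (sym top≡β') top≡t) p') α'≢[])
  same-lower (_ , inj₂ (inj₂ (_ , x , φ , e , (_ , refl)))) (_ , inj₂ (inj₂ (_ , x' , φ' , e' , (_ , refl))))
    with trans (sym e) e'
  ... | refl = refl

  same-upper : ∀ {a a' c} → BdW a c → BdW a' c → a ≡ a'
  same-upper {a} {a'} (b , inj₁ (α , β , p , α≢[] , top≡α , c≡)) (b' , inj₁ (α' , β' , p' , α'≢[] , top≡α' , c≡')) =
    Chn.insert-injectiveʳ (proj₁ b) (proj₁ b') (proj₁ facts) (subst (_∉ a') (sym β≡β') (proj₁ facts'))
      (trans (sym c≡) (trans c≡' (cong (λ β → Chn.insert β a') (sym β≡β'))))
    where
    facts = lift-facts b p α≢[] top≡α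
    facts' = lift-facts b' p' α'≢[] top≡α'
    β≡β' : β ≡ β'
    β≡β' = trans (sym (trans (cong top c≡) (proj₂ (proj₂ facts)))) (trans (cong top c≡') (proj₂ (proj₂ facts')))
  same-upper (b , inj₁ lt) (b' , inj₂ (inj₁ pc)) with lift-upper b lt | pair-upper b' pc
  ... | α , p , _ , α∈ | α' , p' , _ , α'∉ with W-lower-unique p p'
  ...   | refl = ⊥-elim (α'∉ α∈)
  same-upper (b , inj₁ lt) (b' , inj₂ (inj₂ cc)) with lift-upper b lt
  ... | α , p , α≢[] , _ = ⊥-elim (t-not-upper (subst (W α) (critical-upper b' cc) p) α≢[])
  same-upper (b , inj₂ (inj₁ pc)) (b' , inj₁ lt) with pair-upper b pc | lift-upper b' lt
  ... | α , p , _ , α∉ | α' , p' , _ , α'∈ with W-lower-unique p p'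
  ...   | refl = ⊥-elim (α∉ α'∈)
  same-upper (b , inj₂ (inj₁ pc@(α , β , p , _ , top≡β , _ , x , x∉ , ins , step)))
             (b' , inj₂ (inj₁ pc'@(α' , β' , p' , _ , top≡β' , _ , x' , _ , ins' , step')))
    with trans (sym top≡β) (trans (sym (proj₂ (proj₂ (pair-cone-facts b pc)))) (trans (proj₂ (proj₂ (pair-cone-facts b' pc'))) top≡β'))
  ... | refl with W-lower-unique p p'
  ...   | refl with Vtx.insert-injectiveˡ x∉ (trans ins (sym ins'))
  ...     | refl = cone-injective b b' step step'
  same-upper (b , inj₂ (inj₁ pc)) (b' , inj₂ (inj₂ cc)) with pair-upper b pc
  ... | α , p , α≢[] , _ = ⊥-elim (t-not-upper (subst (W α) (critical-upper b' cc) p) α≢[])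
  same-upper (b , inj₂ (inj₂ cc)) (b' , inj₁ lt) with lift-upper b' lt
  ... | α , p , α≢[] , _ = ⊥-elim (t-not-upper (subst (W α) (critical-upper b cc) p) α≢[])
  same-upper (b , inj₂ (inj₂ cc)) (b' , inj₂ (inj₁ pc)) with pair-upper b' pc
  ... | α , p , α≢[] , _ = ⊥-elim (t-not-upper (subst (W α) (critical-upper b cc) p) α≢[])
  same-upper (b , inj₂ (inj₂ (top≡t , x , φ , e , step))) (b' , inj₂ (inj₂ (top≡t' , x' , φ' , e' , step')))
    with trans (sym (cone-keeps-lowestPresent b top≡t e step)) (cone-keeps-lowestPresent b' top≡t' e' step')
  ... | refl = cone-injective b b' step step'

  not-lower-and-upper : ∀ {a c e} → BdW a c → BdW c e → ⊥
  not-lower-and-upper (b , inj₁ lt) (_ , inj₁ (_ , β' , p' , _ , top≡α' , _)) with lift-upper b lt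
  ... | α , p , _ = W-lower≢upper p (subst (λ σ → W σ β') (sym top≡α') p')
  not-lower-and-upper (b , inj₁ lt) (_ , inj₂ (inj₁ (α' , _ , p' , _ , top≡β' , α'∉ , _))) with lift-upper b lt
  ... | α , p , _ , α∈ with W-lower-unique p (subst (W α') (sym top≡β') p')
  ...   | refl = α'∉ α∈
  not-lower-and-upper (b , inj₁ lt) (_ , inj₂ (inj₂ (top≡t , _))) with lift-upper b lt
  ... | α , p , α≢[] , _ = t-not-upper (subst (W α) top≡t p) α≢[]
  not-lower-and-upper (b , inj₂ (inj₁ pc)) (_ , inj₁ (_ , β' , p' , _ , top≡α' , _)) with pair-upper b pc
  ... | α , p , _ = W-lower≢upper p (subst (λ σ → W σ β') (sym top≡α') p')
  not-lower-and-upper (b , inj₂ (inj₁ pc@(α , β , p , _ , top≡β , _ , x , x∉ , ins , step)))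
                      (_ , inj₂ (inj₁ (α' , β' , p' , _ , top≡β' , _ , x' , _ , ins' , step')))
    with trans (sym top≡β) (trans (sym (proj₂ (proj₂ (pair-cone-facts b pc)))) top≡β')
  ... | refl with W-lower-unique p p'
  ...   | refl with Vtx.insert-injectiveˡ x∉ (trans ins (sym ins'))
  ...     | refl = cone-not-twice step step'
  not-lower-and-upper (b , inj₂ (inj₁ pc)) (_ , inj₂ (inj₂ (top≡t , _))) with pair-upper b pc
  ... | α , p , α≢[] , _ = t-not-upper (subst (W α) top≡t p) α≢[]
  not-lower-and-upper (b , inj₂ (inj₂ cc)) (_ , inj₁ (_ , β' , p' , _ , top≡α' , _)) =
    t-not-lower (subst (λ σ → W σ β') (trans (sym top≡α') (critical-upper b cc)) p')
  not-lower-and-upper (b , inj₂ (inj₂ cc)) (_ , inj₂ (inj₁ (α' , _ , p' , α'≢[] , top≡β' , _))) =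
    t-not-upper (subst (W α') (trans (sym top≡β') (critical-upper b cc)) p') α'≢[]
  not-lower-and-upper (b , inj₂ (inj₂ (top≡t , x , φ , e , step))) (_ , inj₂ (inj₂ (_ , x' , φ' , e' , step')))
    with trans (sym (cone-keeps-lowestPresent b top≡t e step)) e'
  ... | refl = cone-not-twice step step'

  BdW-isDVF : IsDVF (_<ₗ_ _≺_) BdS BdW
  BdW-isDVF = record { pairsInK = BdW-facet ; atMostOnce = at-most-once }
    where
    at-most-once : ∀ {a c a' c'} → BdW a c → BdW a' c' → (a ≡ a' ⊎ a ≡ c' ⊎ c ≡ a' ⊎ c ≡ c') → a ≡ a' × c ≡ c'
    at-most-once P Q (inj₁ refl) = refl , same-lower P Q
    at-most-once P Q (inj₂ (inj₁ refl)) = ⊥-elim (not-lower-and-upper Q P)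
    at-most-once P Q (inj₂ (inj₂ (inj₁ refl))) = ⊥-elim (not-lower-and-upper P Q)
    at-most-once P Q (inj₂ (inj₂ (inj₂ refl))) = same-upper P Q , refl

  S-t : S t
  S-t = proj₁ t-critical

  topFlag : Chain
  topFlag = suffixFlag t

  topFlag-Bd : BdS topFlag
  topFlag-Bd = suffixFlag-Bd S-t

  top-topFlag : top topFlag ≡ t
  top-topFlag = top-suffixFlag S-t t≢[]

  ∈-topFlag⁺ : ∀ {ρ} → ρ ∈ suffixes t → ρ ∈ topFlag
  ∈-topFlag⁺ = Chn.∈-fromList⁺ (suffixes t)

  ∈-topFlag⁻ : ∀ {ρ} → ρ ∈ topFlag → ρ ∈ suffixes t
  ∈-topFlag⁻ = Chn.∈-fromList⁻ (suffixes t)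

  t∈topFlag : t ∈ topFlag
  t∈topFlag = ∈-topFlag⁺ (suffixes-self t≢[])

  BdW-lower-nonempty : ∀ {a c} → BdW a c → a ≢ []
  BdW-lower-nonempty (_ , inj₁ (_ , _ , _ , α≢[] , top≡α , _)) refl = α≢[] (trans (sym top≡α) top-[])
  BdW-lower-nonempty (_ , inj₂ (inj₁ (_ , _ , p , _ , top≡β , _))) refl = W-upper≢[] p (trans (sym top≡β) top-[])
  BdW-lower-nonempty (_ , inj₂ (inj₂ (top≡t , _))) refl = t≢[] (trans (sym top≡t) top-[])

  topFlag-not-lower : ∀ {e} → ¬ BdW topFlag e
  topFlag-not-lower (_ , inj₁ (α , β , p , _ , top≡α , _)) =
    t-not-lower (subst (λ σ → W σ β) (trans (sym top≡α) top-topFlag) p)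
  topFlag-not-lower (_ , inj₂ (inj₁ (α , β , p , α≢[] , top≡β , _))) =
    t-not-upper (subst (W α) (trans (sym top≡β) top-topFlag) p) α≢[]
  topFlag-not-lower (_ , inj₂ (inj₂ (top≡t , x , φ , e , (f∉ , _)))) with lowestPresent-at topFlag-Bd top≡t e
  ... | x∷φ∈ , φ∉ , _ with φ Chn.≟ []
  ...   | no φ≢[] = φ∉ (∈-topFlag⁺ (suffix-tail t x∷φ∈ φ≢[]))
  ...   | yes refl = f∉ (subst (_∈ topFlag) (sym apex≡) [x]∈)
    where
    [x]∈ : [ x ] ∈ topFlag
    [x]∈ = ∈-topFlag⁺ x∷φ∈
    apex≡ : apex x topFlag ≡ [ x ]
    apex≡ = Vtx.⊆-antisym (Apex.apex-sorted topFlag-Bd x) [-] (Apex.apex-⊆ topFlag-Bd x [x]∈ (here refl))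
              (λ { (here refl) → x∈apex x topFlag })

  topFlag-not-upper : ∀ {a} → ¬ BdW a topFlag
  topFlag-not-upper (b , inj₁ lt) with lift-upper b lt
  ... | α , p , α≢[] , _ = t-not-upper (subst (W α) top-topFlag p) α≢[]
  topFlag-not-upper (b , inj₂ (inj₁ pc)) with pair-upper b pc
  ... | α , p , α≢[] , _ = t-not-upper (subst (W α) top-topFlag p) α≢[]
  topFlag-not-upper {a} (b , inj₂ (inj₂ (top≡t , x , φ , e , (f∉ , c≡)))) with lowestPresent-at b top≡t e
  ... | x∷φ∈ , φ∉ , above with suffixes-nested t f∈t x∷φ∈ (Vtx.⊆⇒length≤ (Apex.apex-sorted b x) (Vtx.suffix-sorted (canonical S-t) x∷φ∈)
                                                 (Apex.apex-⊆ b x x∷φ∈a (here refl)))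
    where
    f∈t : apex x a ∈ suffixes t
    f∈t = ∈-topFlag⁻ (subst (apex x a ∈_) (sym c≡) (Chn.∈-insert-self (apex x a) a))
    x∷φ∈a : x ∷ φ ∈ a
    x∷φ∈a = above x∷φ∈ ≤-refl
  ...   | here f≡ = f∉ (subst (_∈ a) (sym f≡) (above x∷φ∈ ≤-refl))
  ...   | there f∈φ = Vtx.head∉tail (Vtx.suffix-sorted (canonical S-t) x∷φ∈) (suffix-⊆ φ f∈φ (x∈apex x a))

  module _ {w} (w-critical : Critical _≺_ S W w) (w≢t : w ≢ t) where

    vertexFlag-Bd : BdS [ w ]
    vertexFlag-Bd = [-] , (proj₁ w-critical , proj₁ (proj₂ w-critical)) ∷ [] , [] ∷ []

    top-vertexFlag : top [ w ] ≡ w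
    top-vertexFlag = top-unique vertexFlag-Bd (here refl) (λ { (here refl) → id })

    vertexFlag-not-lower : ∀ {e} → ¬ BdW [ w ] e
    vertexFlag-not-lower (_ , inj₁ (α , β , p , _ , top≡α , _)) =
      critical-not-lower w-critical (subst (λ σ → W σ β) (trans (sym top≡α) top-vertexFlag) p)
    vertexFlag-not-lower (_ , inj₂ (inj₁ (α , β , p , α≢[] , top≡β , _))) =
      α≢[] (critical-lower≡[] w-critical (subst (W α) (trans (sym top≡β) top-vertexFlag) p))
    vertexFlag-not-lower (_ , inj₂ (inj₂ (top≡t , _))) = w≢t (trans (sym top-vertexFlag) top≡t)

  vertexFlag-not-upper : ∀ {a w} → ¬ BdW a [ w ]
  vertexFlag-not-upper {[]} P = BdW-lower-nonempty P refl
  vertexFlag-not-upper {_ ∷ _} P with proj₂ (proj₂ (proj₂ (BdW-facet P)))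
  ... | ()

  cone-below : ∀ {c} x → BdS c → apex x c ∈ c → ConeStep x (Chn.remove (apex x c) c) c
  cone-below {c} x b f∈ =
    subst (_∉ a) (sym apex≡) f∉a , trans (sym (Chn.insert-remove (proj₁ b) f∈)) (cong (λ f → Chn.insert f a) (sym apex≡))
    where
    a = Chn.remove (apex x c) c
    apex≡ : apex x a ≡ apex x c
    apex≡ = trans (sym (apex-insert a (x∈apex x c))) (cong (apex x) (Chn.insert-remove (proj₁ b) f∈))
    f∉a : apex x c ∉ a
    f∉a f∈a = proj₂ (Chn.∈-remove⁻ c f∈a) refl

  module Unpaired {c} (b : BdS c) (c≢[] : c ≢ []) (no-up : ∀ e → ¬ BdW c e) (no-down : ∀ a → ¬ BdW a c) where

    top∈ : top c ∈ c
    top∈ = ≢[]⇒top∈ b c≢[]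

    top≢[] : top c ≢ []
    top≢[] = ∈⇒nonempty b top∈

    not-lower : ∀ {β} → ¬ W (top c) β
    not-lower p = no-up _ (b , inj₁ (top c , _ , p , top≢[] , refl , refl))

    not-upper : ∀ {α} → W α (top c) → α ≡ []
    not-upper {α} p with α Chn.≟ []
    ... | yes α≡[] = α≡[]
    ... | no α≢[] with α Chn.∈? c
    ...   | yes α∈ = ⊥-elim (no-down (Chn.remove (top c) c)
                       (remove-Bd (top c) b , inj₁ (α , top c , p , α≢[] , top≡α , sym (Chn.insert-remove (proj₁ b) top∈))))
      where
      top≡α : top (Chn.remove (top c) c) ≡ α
      top≡α = top-unique (remove-Bd (top c) b) (Chn.∈-remove⁺ c α∈ (λ e → <-irrefl (cong length e) (≤-reflexive (W-length p)))) ⊆α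
        where
        ⊆α : ∀ {ρ} → ρ ∈ Chn.remove (top c) c → ρ ⊆ α
        ⊆α ρ∈ with Chn.∈-remove⁻ c ρ∈
        ... | ρ∈c , ρ≢top = length≤⇒⊆ b ρ∈c α∈ (≤-pred (≤-trans (⊂⇒length< (∈⇒S b ρ∈c) (∈⇒S b top∈) (⊆-top b ρ∈c) ρ≢top)
                                                              (≤-reflexive (sym (W-length p)))))
    ...   | no α∉ with W-vertex p
    ...     | x , x∉α , ins with apex x c Chn.∈? c
    ...       | no f∉ = ⊥-elim (no-up _ (b , inj₂ (inj₁ (α , top c , p , α≢[] , refl , α∉ , x , x∉α , ins , (f∉ , refl)))))
    ...       | yes f∈ = ⊥-elim (no-down _ (remove-Bd (apex x c) b ,
                           inj₂ (inj₁ (α , top c , p , α≢[] , remove-top b f∈ f≢top , α∉ ∘ proj₁ ∘ Chn.∈-remove⁻ c ,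
                                       x , x∉α , ins , cone-below x b f∈))))
      where
      f≢top : apex x c ≢ top c
      f≢top e = <-irrefl (cong length e) (Apex.apex-shorter b x top∈ (canonical (W-S-lower p)) x∉α ins α∉ α≢[])

    top-t : top c ≡ t → c ≡ topFlag
    top-t top≡t with lowestPresent-spec b (top≡t⇒t∈ b top≡t)
    ... | x , φ , e , x∷φ∈ , φ∉ , above with φ Chn.≟ []
    ...   | yes refl = Chn.⊆-antisym (proj₁ b) (proj₁ topFlag-Bd) c⊆ ⊆c
      where
      ⊆c : topFlag ⊆ c
      ⊆c ρ∈ = above (∈-topFlag⁻ ρ∈) (nonempty⇒length>0 (suffix-nonempty t (∈-topFlag⁻ ρ∈)))
      c⊆ : c ⊆ topFlag
      c⊆ {ρ} ρ∈ with suffix-of-length t (nonempty⇒length>0 (∈⇒nonempty b ρ∈))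
                      (Vtx.⊆⇒length≤ (∈⇒sorted b ρ∈) (canonical S-t) (subst (ρ ⊆_) top≡t (⊆-top b ρ∈)))
      ... | ψ , ψ∈ , lψ = subst (_∈ topFlag) (length-injective b (⊆c (∈-topFlag⁺ ψ∈)) ρ∈ lψ) (∈-topFlag⁺ ψ∈)
    ...   | no φ≢[] with apex x c Chn.∈? c
    ...     | no f∉ = ⊥-elim (no-up _ (b , inj₂ (inj₂ (top≡t , x , φ , e , (f∉ , refl)))))
    ...     | yes f∈ = ⊥-elim (no-down _ (remove-Bd (apex x c) b , inj₂ (inj₂ (top-a , x , φ , lowest-a , cone-below x b f∈))))
      where
      sxφ = Vtx.suffix-sorted (canonical S-t) x∷φ∈
      f-short : length (apex x c) < length (x ∷ φ)
      f-short = Apex.apex-shorter b x (above x∷φ∈ ≤-refl) (Linked.tail sxφ) (Vtx.head∉tail sxφ) (Vtx.insert-head sxφ) φ∉ φ≢[]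
      a = Chn.remove (apex x c) c
      top-a : top a ≡ t
      top-a = trans (remove-top b f∈ λ e → <-irrefl (cong length e)
                       (≤-trans f-short (≤-trans (suffix-length≤ t x∷φ∈) (≤-reflexive (cong length (sym top≡t))))))
                    top≡t
      above-a : ∀ {ρ} → ρ ∈ suffixes t → length φ < length ρ → ρ ∈ a
      above-a ρ∈ lt = Chn.∈-remove⁺ c (above ρ∈ lt) (λ e → <-irrefl (cong length (sym e)) (≤-trans f-short lt))
      lowest-a : lowestPresent a t ≡ x ∷ φ
      lowest-a = lowestPresent-unique (x∷φ∈ , φ∉ ∘ proj₁ ∘ Chn.∈-remove⁻ c , above-a)

    top-critical : ¬ ¬ Critical _≺_ S W (top c)
    top-critical k = ¬¬-excluded-middle {A = ∃[ α ] W α (top c)} λ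
      { (yes (α , p)) → let p′ = subst (λ α → W α (top c)) (not-upper p) p in
                        k (∈⇒S b top∈ , top≢[] , inj₂ (sym (W-length p′) , p′))
      ; (no ¬up) → k (∈⇒S b top∈ , top≢[] , inj₁ λ α β p → (λ { refl → not-lower p }) , (λ { refl → ¬up (α , p) }))
      }

  unpaired⇒critical : ∀ {c} → BdS c → c ≢ [] → (∀ e → ¬ BdW c e) → (∀ a → ¬ BdW a c) → Critical (_<ₗ_ _≺_) BdS BdW c
  unpaired⇒critical b c≢[] no-up no-down =
    b , c≢[] , inj₁ λ a c′ P → (λ { refl → no-up c′ P }) , (λ { refl → no-down a P })

  topFlag-critical : Critical (_<ₗ_ _≺_) BdS BdW topFlag
  topFlag-critical = unpaired⇒critical topFlag-Bd (λ e → t≢[] (trans (sym top-topFlag) (trans (cong top e) top-[])))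
                       (λ _ → topFlag-not-lower) (λ _ → topFlag-not-upper)

  vertexFlag-critical : ∀ {w} → Critical _≺_ S W w → w ≢ t → Critical (_<ₗ_ _≺_) BdS BdW [ w ]
  vertexFlag-critical w-critical w≢t =
    unpaired⇒critical (vertexFlag-Bd w-critical w≢t) (λ ()) (λ _ → vertexFlag-not-lower w-critical w≢t) (λ _ → vertexFlag-not-upper)

  top-vertex⇒vertexFlag : ∀ {c w} → BdS c → c ≢ [] → length w ≡ 1 → top c ≡ w → c ≡ [ w ]
  top-vertex⇒vertexFlag {c} {w} b c≢[] lw top≡w = Chn.⊆-antisym (proj₁ b) [-] c⊆ λ { (here refl) → w∈ }
    where
    w∈ = subst (_∈ c) top≡w (≢[]⇒top∈ b c≢[])
    c⊆ : c ⊆ [ w ]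
    c⊆ ρ∈ = here (Vtx.⊆∧length≥⇒≡ (∈⇒sorted b ρ∈) (∈⇒sorted b w∈) (subst (_ ⊆_) top≡w (⊆-top b ρ∈))
                    (≤-trans (≤-reflexive lw) (nonempty⇒length>0 (∈⇒nonempty b ρ∈))))

  critical-flags : ∀ {w} → length w ≡ 1 → (∀ σ → Critical _≺_ S W σ → σ ≡ t ⊎ σ ≡ w) →
                   ∀ c → Critical (_<ₗ_ _≺_) BdS BdW c → c ≡ topFlag ⊎ c ≡ [ w ]
  critical-flags _ _ c (_ , _ , inj₂ (_ , P)) = ⊥-elim (BdW-lower-nonempty P refl)
  critical-flags {w} lw only c (b , c≢[] , inj₁ unpaired) with c ≟ topFlag | c ≟ [ w ]
    where _≟_ = ≡-dec Chn._≟_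
  ... | yes c≡ | _ = inj₁ c≡
  ... | no _ | yes c≡ = inj₂ c≡
  ... | no c≢topFlag | no c≢[w] = ⊥-elim (U.top-critical λ top-critical → case (only (top c) top-critical))
    where
    module U = Unpaired b c≢[] (λ e P → proj₁ (unpaired c e P) refl) (λ a P → proj₂ (unpaired a c P) refl)
    case : top c ≡ t ⊎ top c ≡ w → ⊥
    case (inj₁ top≡t) = c≢topFlag (U.top-t top≡t)
    case (inj₂ top≡w) = c≢[w] (top-vertex⇒vertexFlag b c≢[] lw top≡w)

module _ {A : Set} {R : Rel A 0ℓ} where

  Star⇒TransClosure : ∀ {x y z} → Star R x y → R y z → TransClosure R x z
  Star⇒TransClosure ε r = [ r ]⁺
  Star⇒TransClosure (r ◅ rs) r′ = r ∷ Star⇒TransClosure rs r′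

  TransClosure⇒Star : ∀ {x y} → TransClosure R x y → Star R x y
  TransClosure⇒Star [ r ]⁺ = r ◅ ε
  TransClosure⇒Star (r ∷ rs) = r ◅ TransClosure⇒Star rs

module Hasse {V : Set} {_≺_ : Rel V 0ℓ} (sto : IsStrictTotalOrder _≡_ _≺_) {S : List V → Set} (K : IsComplex _≺_ S)
             {W : List V → List V → Set} (dvf : IsDVF _≺_ S W) (gradient : IsGradient _≺_ W) where

  open DVF sto K dvf

  Descent : List V → List V → Set
  Descent σ σ' = σ' ⊆ σ × length σ' < length σ × ¬ W σ' σ

  HasseStep : List V → List V → Set
  HasseStep σ σ' = Descent σ σ' ⊎ W σ σ'

  Upper : List V → Set
  Upper τ = ∃[ α ] W α τ

  Traj : List V → List V → Set
  Traj = TrajStep _≺_ W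

  -- Along a Hasse path from the upper face β₀ of a pair, every face is too short to return, or is the
  -- upper face of a pair reached from β₀ by a trajectory, or a facet of such a face not paired with it.
  module FromUpper (β₀ : List V) where

    Low : List V → Set
    Low τ = suc (suc (length τ)) ≤ length β₀ ⊎ (suc (length τ) ≡ length β₀ × Upper τ)

    Reached : List V → Set
    Reached τ = Upper τ × length τ ≡ length β₀ × TransClosure Traj β₀ τ

    FacetOfReached : List V → Set
    FacetOfReached τ = suc (length τ) ≡ length β₀ ×
                       ∃[ β ] Star Traj β₀ β × Upper β × length β ≡ length β₀ × τ ⊆ β × ¬ W τ β

    Invariant : List V → Set
    Invariant τ = Low τ ⊎ Reached τ ⊎ FacetOfReached τ

    from-upper : ∀ {τ τ'} → Upper τ → length τ ≡ length β₀ → Star Traj β₀ τ → HasseStep τ τ' → Invariant τ'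
    from-upper {τ} {τ'} up lτ path (inj₁ (τ'⊆ , lt , ¬W)) with suc (length τ') ℕ.≟ length τ
    ... | yes l = inj₂ (inj₂ (trans l lτ , τ , path , up , lτ , τ'⊆ , ¬W))
    ... | no l = inj₁ (inj₁ (≤-trans (≤∧≢⇒< lt l) (≤-reflexive lτ)))
    from-upper (_ , q) _ _ (inj₂ p) = ⊥-elim (W-lower≢upper q p)

    from-low : ∀ {τ τ'} → Low τ → HasseStep τ τ' → Invariant τ'
    from-low (inj₁ l) (inj₁ (_ , lt , _)) = inj₁ (inj₁ (≤-trans (s≤s lt) (≤-trans (n≤1+n _) l)))
    from-low {τ} (inj₁ l) (inj₂ p) with suc (suc (length τ)) ℕ.≟ length β₀
    ... | yes e = inj₁ (inj₂ (trans (cong suc (sym (W-length p))) e , τ , p))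
    ... | no e = inj₁ (inj₁ (subst (λ n → suc n ≤ length β₀) (cong suc (W-length p)) (≤∧≢⇒< l e)))
    from-low (inj₂ (e , _)) (inj₁ (_ , lt , _)) = inj₁ (inj₁ (≤-trans (s≤s lt) (≤-reflexive e)))
    from-low (inj₂ (_ , (_ , q))) (inj₂ p) = ⊥-elim (W-lower≢upper q p)

    from-facet : ∀ {τ τ'} → FacetOfReached τ → HasseStep τ τ' → Invariant τ'
    from-facet (e , _) (inj₁ (_ , lt , _)) = inj₁ (inj₁ (≤-trans (s≤s lt) (≤-reflexive e)))
    from-facet {τ} {τ'} (e , β , path , (_ , q) , lβ , τ⊆β , ¬W) (inj₂ p) =
      inj₂ (inj₁ ((τ , p) , lτ' , Star⇒TransClosure path step))
      where
      lτ' : length τ' ≡ length β₀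
      lτ' = trans (sym (W-length p)) e
      step : Traj β τ'
      step = trans lβ (sym lτ') , (λ { refl → ¬W p }) , τ , p , τ⊆β ,
             λ β⊆τ → <-irrefl refl (≤-trans (≤-reflexive (trans e (sym lβ)))
                                      (Vtx.⊆⇒length≤ (canonical (W-S-upper q)) (canonical (W-S-lower p)) β⊆τ))

    step : ∀ {τ τ'} → Invariant τ → HasseStep τ τ' → Invariant τ'
    step (inj₁ low) = from-low low
    step (inj₂ (inj₁ (up , lτ , path))) = from-upper up lτ (TransClosure⇒Star path)
    step (inj₂ (inj₂ facet)) = from-facet facet

    invariant : ∀ {τ} → Upper β₀ → TransClosure HasseStep β₀ τ → Invariant τ
    invariant up (h ∷ hs) = go (from-upper up refl ε h) hs
      where
      go : ∀ {τ τ'} → Invariant τ → TransClosure HasseStep τ τ' → Invariant τ'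
      go i [ h ]⁺ = step i h
      go i (h ∷ hs) = go (step i h) hs
    invariant up [ h ]⁺ = from-upper up refl ε h

    not-invariant : ¬ Invariant β₀
    not-invariant (inj₁ (inj₁ l)) = <-irrefl refl (≤-trans (n≤1+n _) l)
    not-invariant (inj₁ (inj₂ (e , _))) = 1+n≢n e
    not-invariant (inj₂ (inj₁ (_ , _ , cycle))) = gradient β₀ cycle
    not-invariant (inj₂ (inj₂ (e , _))) = 1+n≢n e

  W-step-on-path : ∀ {σ τ} → TransClosure HasseStep σ τ →
                   length τ < length σ ⊎ ∃[ α ] ∃[ β ] W α β × Star HasseStep σ α × Star HasseStep β τ
  W-step-on-path [ inj₁ (_ , lt , _) ]⁺ = inj₁ lt
  W-step-on-path [ inj₂ p ]⁺ = inj₂ (_ , _ , p , ε , ε)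
  W-step-on-path (inj₁ descent@(_ , lt , _) ∷ hs) with W-step-on-path hs
  ... | inj₁ l = inj₁ (≤-trans l (≤-trans (n≤1+n _) lt))
  ... | inj₂ (α , β , p , before , after) = inj₂ (α , β , p , inj₁ descent ◅ before , after)
  W-step-on-path (inj₂ p ∷ hs) = inj₂ (_ , _ , p , ε , TransClosure⇒Star hs)

  Hasse-acyclic : ∀ {σ} → ¬ TransClosure HasseStep σ σ
  Hasse-acyclic cycle with W-step-on-path cycle
  ... | inj₁ l = <-irrefl refl l
  ... | inj₂ (α , β , p , before , after) =
    FromUpper.not-invariant β (FromUpper.invariant β (α , p) (Star⇒TransClosure (after ◅◅ before) (inj₂ p)))

module _ {A : Set} {R : Rel A 0ℓ} where

  Preserving : {B : Set} → (A → B) → Rel A 0ℓ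
  Preserving f u v = R u v × f u ≡ f v

  preserved : ∀ {B : Set} {f : A → B} {x y} → TransClosure (Preserving f) x y → f x ≡ f y
  preserved [ _ , e ]⁺ = e
  preserved ((_ , e) ∷ rs) = trans e (preserved rs)

  split-by-image : ∀ {B : Set} {Q : Rel B 0ℓ} (f : A → B) → (∀ {u v} → R u v → f u ≡ f v ⊎ TransClosure Q (f u) (f v)) →
                   ∀ {x y} → TransClosure R x y → TransClosure Q (f x) (f y) ⊎ TransClosure (Preserving f) x y
  split-by-image f step [ r ]⁺ with step r
  ... | inj₁ e = inj₂ [ r , e ]⁺
  ... | inj₂ q = inj₁ q
  split-by-image {Q = Q} f step {y = y} (r ∷ rs) with step r | split-by-image f step rs
  ... | inj₁ e | inj₂ rs′ = inj₂ ((r , e) ∷ rs′)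
  ... | inj₁ e | inj₁ q = inj₁ (subst (λ b → TransClosure Q b (f y)) (sym e) q)
  ... | inj₂ q | inj₁ q′ = inj₁ (q ++⁺ q′)
  ... | inj₂ q | inj₂ rs′ = inj₁ (subst (TransClosure Q _) (preserved rs′) q)

  module _ (f : A → ℕ) where

    path-monotone : (∀ {u v} → R u v → f u ≤ f v) → ∀ {x y} → TransClosure R x y → f x ≤ f y
    path-monotone mono [ r ]⁺ = mono r
    path-monotone mono (r ∷ rs) = ≤-trans (mono r) (path-monotone mono rs)

    monotone-constant-on-cycle : (∀ {u v} → R u v → f u ≤ f v) → ∀ {x} → TransClosure R x x →
                                 TransClosure (λ u v → R u v × f v ≡ f x) x x
    monotone-constant-on-cycle mono {x} cycle = go cycle ≤-refl ≤-refl
      where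
      go : ∀ {u y} → TransClosure R u y → f x ≤ f u → f y ≤ f x → TransClosure (λ u v → R u v × f v ≡ f x) u y
      go [ r ]⁺ x≤u y≤x = [ r , ≤-antisym y≤x (≤-trans x≤u (mono r)) ]⁺
      go (r ∷ rs) x≤u y≤x = (r , e) ∷ go rs (≤-reflexive (sym e)) y≤x
        where e = ≤-antisym (≤-trans (path-monotone mono rs) y≤x) (≤-trans x≤u (mono r))

    path-antitone : (∀ {u v} → R u v → f v ≤ f u) → ∀ {x y} → TransClosure R x y → f y ≤ f x
    path-antitone anti [ r ]⁺ = anti r
    path-antitone anti (r ∷ rs) = ≤-trans (path-antitone anti rs) (anti r)

    eventually-decreasing⇒acyclic : (∀ {u v} → R u v → u ≢ v) → (∀ {u v} → R u v → f v ≤ f u) →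
                                    (∀ {u v w} → R u v → R v w → f w < f v) → ∀ {x} → ¬ TransClosure R x x
    eventually-decreasing⇒acyclic irrefl anti strict [ r ]⁺ = irrefl r refl
    eventually-decreasing⇒acyclic irrefl anti strict (r ∷ [ r′ ]⁺) = <-irrefl refl (<-≤-trans (strict r r′) (anti r))
    eventually-decreasing⇒acyclic irrefl anti strict (r ∷ r′ ∷ rs) =
      <-irrefl refl (<-≤-trans (strict r r′) (≤-trans (anti r) (path-antitone anti rs)))

map⁺ : ∀ {A : Set} {R Q : Rel A 0ℓ} → (∀ {x y} → R x y → Q x y) → ∀ {x y} → TransClosure R x y → TransClosure Q x y
map⁺ f [ r ]⁺ = [ f r ]⁺
map⁺ f (r ∷ rs) = f r ∷ map⁺ f rs

module BdGradient {V : Set} {_≺_ : Rel V 0ℓ} (sto : IsStrictTotalOrder _≡_ _≺_) {S : List V → Set} (K : IsComplex _≺_ S)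
                  {W : List V → List V → Set} (dvf : IsDVF _≺_ S W) {t : List V} (t-critical : Critical _≺_ S W t)
                  (gradient : IsGradient _≺_ W) where

  open BdField sto K dvf t-critical
  open Hasse sto K dvf gradient

  Step : Chain → Chain → Set
  Step c c' = BdS c × TrajStep (_<ₗ_ _≺_) BdW c c'

  descent-to : ∀ {c σ} → BdS c → σ ∈ c → σ ≢ top c → ¬ W σ (top c) → Descent (top c) σ
  descent-to b σ∈ σ≢top ¬W = ⊆-top b σ∈ , ⊂⇒length< (∈⇒S b σ∈) (∈⇒S b (top-∈ b σ∈)) (⊆-top b σ∈) σ≢top , ¬W

  lower-length : ∀ {c c' a} → Step c c' → BdW a c' → suc (length a) ≡ length c
  lower-length (_ , lc , _) P = trans (proj₂ (proj₂ (proj₂ (BdW-facet P)))) (sym lc)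

  lift-moves-top : ∀ {c c' a α β} → Step c c' → BdW a c' → a ⊆ c → W α β → α ≢ [] → top a ≡ α → c' ≡ Chn.insert β a →
                   top c ≢ β
  lift-moves-top {c} {c'} {a} {α} {β} step@(b , _ , c≢c' , _) P@(ba , _) a⊆c p α≢[] top≡α c'≡ top≡β =
    c≢c' (trans (sym (Chn.insert-missing (proj₁ b) β∈c (proj₁ ba) a⊆c (lower-length step P) (proj₁ (lift-facts ba p α≢[] top≡α))))
                (sym c'≡))
    where
    β∈c : β ∈ c
    β∈c = subst (_∈ c) top≡β (≢[]⇒top∈ b λ { refl → W-upper≢[] p (trans (sym top≡β) top-[]) })

  cone-top-step : ∀ {c c' a} → BdS c → BdS a → a ⊆ c → top a ≢ [] → top c' ≡ top a → ¬ W (top a) (top c) →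
                  top c ≡ top c' ⊎ TransClosure HasseStep (top c) (top c')
  cone-top-step {c} {c'} {a} b ba a⊆c top≢[] top≡ ¬W with top a Chn.≟ top c
  ... | yes e = inj₁ (trans (sym e) (sym top≡))
  ... | no top≢ = inj₂ [ inj₁ (subst (Descent (top c)) (sym top≡) (descent-to b (a⊆c (top≢[]⇒top∈ ba top≢[])) top≢ ¬W)) ]⁺

  top-step : ∀ {c c'} → Step c c' → top c ≡ top c' ⊎ TransClosure HasseStep (top c) (top c')
  top-step {c} {c'} step@(b , _ , _ , a , P@(ba , inj₁ (α , β , p , α≢[] , top≡α , c'≡)) , a⊆c , _) with α Chn.≟ top c
  ... | yes refl = inj₂ [ inj₂ (subst (W α) (sym top≡β) p) ]⁺
    where top≡β = trans (cong top c'≡) (proj₂ (proj₂ (lift-facts ba p α≢[] top≡α)))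
  ... | no α≢top = inj₂ (inj₁ (descent-to b α∈c α≢top ¬W) ∷ [ inj₂ (subst (W α) (sym top≡β) p) ]⁺)
    where
    top≡β = trans (cong top c'≡) (proj₂ (proj₂ (lift-facts ba p α≢[] top≡α)))
    α∈c = a⊆c (top≡⇒∈ ba top≡α α≢[])
    ¬W : ¬ W α (top c)
    ¬W q = lift-moves-top step P a⊆c p α≢[] top≡α c'≡ (W-upper-unique q p)
  top-step (b , _ , _ , _ , (ba , inj₂ (inj₁ pc@(α , β , p , _ , top≡β , _))) , a⊆c , _) =
    cone-top-step b ba a⊆c (λ e → W-upper≢[] p (trans (sym top≡β) e)) (proj₂ (proj₂ (pair-cone-facts ba pc)))
      (λ q → W-lower≢upper p (subst (λ σ → W σ _) top≡β q))
  top-step (b , _ , _ , _ , (ba , inj₂ (inj₂ cc@(top≡t , _))) , a⊆c , _) =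
    cone-top-step b ba a⊆c (λ e → t≢[] (trans (sym top≡t) e)) (proj₂ (proj₂ (critical-cone-facts ba cc)))
      (λ q → t-not-lower (subst (λ σ → W σ _) top≡t q))

  ConeTraj : V → Chain → Chain → Set
  ConeTraj x c c' = BdS c × c ≢ c' × ∃[ a ] BdS a × a ⊆ c × suc (length a) ≡ length c × ConeStep x a c'

  count : V → Chain → ℕ
  count x c = length (filter (without? x) c)

  module _ (x : V) where

    filter-sorted : ∀ {c} → BdS c → Chn.Sorted (filter (without? x) c)
    filter-sorted b = Linkedₚ.filter⁺ (without? x) (IsStrictTotalOrder.trans (lex-isStrictTotalOrder sto)) (proj₁ b)

    filter-⊆ : ∀ {a c} → a ⊆ c → filter (without? x) a ⊆ filter (without? x) c
    filter-⊆ {a} a⊆c ρ∈ with ∈-filter⁻ (without? x) {xs = a} ρ∈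
    ... | ρ∈a , x∉ρ = ∈-filter⁺ (without? x) (a⊆c ρ∈a) x∉ρ

    count-cone : ∀ {a c'} → ConeStep x a c' → count x c' ≡ count x a
    count-cone {a} (_ , refl) = cong length (Chn.filter-insert (without? x) a (λ x∉ → x∉ (x∈apex x a)))

    count-antitone : ∀ {c c'} → ConeTraj x c c' → count x c' ≤ count x c
    count-antitone (b , _ , a , ba , a⊆c , _ , step) =
      ≤-trans (≤-reflexive (count-cone step)) (Chn.⊆⇒length≤ (filter-sorted ba) (filter-sorted b) (filter-⊆ a⊆c))

    -- If the second step removes a face containing x, the apex is unchanged and it re-adds that face.
    count-decreasing : ∀ {c c' c''} → ConeTraj x c c' → ConeTraj x c' c'' → count x c'' < count x c'
    count-decreasing {c' = c'} {c''} (_ , _ , a , _ , _ , _ , step@(_ , c'≡)) (b' , c'≢c'' , a' , ba' , a'⊆c' , la' , (f'∉a' , c''≡))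
      with Chn.⊆∧length≡suc⇒insert (proj₁ ba') (proj₁ b') a'⊆c' la'
    ... | e , e∉a' , e≡ with x Vtx.∈? e
    ...   | no x∉e = ≤-trans (s≤s (≤-reflexive (count-cone (f'∉a' , c''≡))))
                       (Chn.⊆∧∉⇒length< (filter-sorted ba') (filter-sorted b') (filter-⊆ a'⊆c')
                          (∈-filter⁺ (without? x) e∈c' x∉e) (e∉a' ∘ proj₁ ∘ ∈-filter⁻ (without? x) {xs = a'}))
      where e∈c' = subst (e ∈_) e≡ (Chn.∈-insert-self e a')
    ...   | yes x∈e = ⊥-elim (c'≢c'' (trans (sym e≡) (trans (cong (λ σ → Chn.insert σ a') (sym f≡e)) (sym c''≡′))))
      where
      same-apex : apex x a' ≡ apex x a
      same-apex = trans (sym (apex-insert a' x∈e)) (trans (cong (apex x) e≡) (apex-of-cone step))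
      c''≡′ : c'' ≡ Chn.insert (apex x a) a'
      c''≡′ = trans c''≡ (cong (λ σ → Chn.insert σ a') same-apex)
      f≡e : apex x a ≡ e
      f≡e with Chn.∈-insert⁻ e a' (subst (apex x a ∈_) (trans (sym c'≡) (sym e≡)) (Chn.∈-insert-self (apex x a) a))
      ... | inj₁ f≡e′ = f≡e′
      ... | inj₂ f∈a' = ⊥-elim (f'∉a' (subst (_∈ a') (sym same-apex) f∈a'))

    no-cone-cycle : ∀ {c} → ¬ TransClosure (ConeTraj x) c c
    no-cone-cycle = eventually-decreasing⇒acyclic (count x) (proj₁ ∘ proj₂) count-antitone count-decreasing

  SameTop : Chain → Chain → Set
  SameTop = Preserving {R = Step} top

  map-fixed-top : ∀ {T} {Q : Chain → Chain → Set} → (∀ {c c'} → SameTop c c' → top c ≡ T → Q c c') →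
                  ∀ {c c'} → TransClosure SameTop c c' → top c ≡ T → TransClosure Q c c'
  map-fixed-top f [ s ]⁺ top≡T = [ f s top≡T ]⁺
  map-fixed-top f (s ∷ ss) top≡T = f s top≡T ∷ map-fixed-top f ss (trans (sym (proj₂ s)) top≡T)

  lift-same-top : ∀ {c c' a} → Step c c' → top c ≡ top c' → BdW a c' → a ⊆ c → ¬ LiftTop a c'
  lift-same-top step same P@(ba , _) a⊆c (α , β , p , α≢[] , top≡α , c'≡) =
    lift-moves-top step P a⊆c p α≢[] top≡α c'≡ (trans same (trans (cong top c'≡) (proj₂ (proj₂ (lift-facts ba p α≢[] top≡α)))))

  pair-cone-traj : ∀ {α T x} → W α T → α ≢ [] → x ∉ α → Vtx.insert x α ≡ T →
                   ∀ {c c'} → SameTop c c' → top c ≡ T → ConeTraj x c c'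
  pair-cone-traj p α≢[] x∉ ins (step@(_ , _ , _ , _ , P@(_ , inj₁ lt) , a⊆c , _) , same) _ =
    ⊥-elim (lift-same-top step same P a⊆c lt)
  pair-cone-traj p α≢[] x∉ ins
    (step@(b , _ , c≢c' , a , P@(ba , inj₂ (inj₁ pc@(α' , β' , p' , _ , top≡β' , _ , x' , x'∉ , ins' , cone))) , a⊆c , _) , same)
    top≡T
    with trans (sym top≡β') (trans (sym (proj₂ (proj₂ (pair-cone-facts ba pc)))) (trans (sym same) top≡T))
  ... | refl with W-lower-unique p p'
  ...   | refl with Vtx.insert-injectiveˡ x∉ (trans ins (sym ins'))
  ...     | refl = b , c≢c' , a , ba , a⊆c , lower-length step P , cone
  pair-cone-traj p α≢[] x∉ ins ((_ , _ , _ , _ , (ba , inj₂ (inj₂ cc)) , _) , same) top≡T =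
    ⊥-elim (t-not-upper (subst (W _) (trans (sym top≡T) (trans same (critical-upper ba cc))) p) α≢[])

  level : Chain → ℕ
  level c = length (lowestPresent c t)

  level-antitone : ∀ {a c} → BdS a → BdS c → t ∈ a → a ⊆ c → level c ≤ level a
  level-antitone {a} {c} ba b t∈a a⊆c with lowestPresent-spec ba t∈a | lowestPresent-spec b (a⊆c t∈a)
  ... | x₂ , φ₂ , e₂ , _ , _ , above₂ | x₁ , φ₁ , e₁ , x∷φ₁∈ , φ₁∉ , _ with level c ≤? level a
  ...   | yes l = l
  ...   | no l = ⊥-elim (φ₁∉ (a⊆c (above₂ (suffix-tail t x∷φ₁∈ φ₁≢[]) longer)))
    where
    longer : length φ₂ < length φ₁
    longer = ≤-pred (≰⇒> (subst₂ (λ m n → ¬ m ≤ n) (cong length e₁) (cong length e₂) l))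
    φ₁≢[] : φ₁ ≢ []
    φ₁≢[] refl with longer
    ... | ()

  critical-step : ∀ {c c'} → SameTop c c' → top c ≡ t →
                  level c ≤ level c' × ∃[ x ] ∃[ φ ] lowestPresent c' t ≡ x ∷ φ × ConeTraj x c c'
  critical-step (step@(_ , _ , _ , _ , P@(_ , inj₁ lt) , a⊆c , _) , same) _ = ⊥-elim (lift-same-top step same P a⊆c lt)
  critical-step ((_ , _ , _ , _ , (ba , inj₂ (inj₁ pc@(α , _ , p , α≢[] , top≡β , _))) , _) , same) top≡t =
    ⊥-elim (t-not-upper (subst (W α) top≡t′ p) α≢[])
    where top≡t′ = trans (sym top≡β) (trans (sym (proj₂ (proj₂ (pair-cone-facts ba pc)))) (trans (sym same) top≡t))
  critical-step (step@(b , _ , c≢c' , a , P@(ba , inj₂ (inj₂ (top≡t′ , x , φ , e , cone))) , a⊆c , _) , _) _ =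
    ≤-trans (level-antitone ba b (top≡t⇒t∈ ba top≡t′) a⊆c) (≤-reflexive (cong length (trans e (sym lowest)))) ,
    x , φ , lowest , (b , c≢c' , a , ba , a⊆c , lower-length step P , cone)
    where lowest = cone-keeps-lowestPresent ba top≡t′ e cone

  lowestPresent-suffix : ∀ {a} → BdS a → t ∈ a → lowestPresent a t ∈ suffixes t
  lowestPresent-suffix b t∈ with lowestPresent-spec b t∈
  ... | _ , _ , e , x∷φ∈ , _ = subst (_∈ suffixes t) (sym e) x∷φ∈

  step-target-Bd : ∀ {c c'} → Step c c' → BdS c'
  step-target-Bd (_ , _ , _ , _ , P , _) = proj₁ (proj₂ (BdW-facet P))

  -- The level is constant on a cycle, which fixes the cone vertex as the head of the lowest present suffix.
  no-critical-cycle : ∀ {c} → BdS c → top c ≡ t → ¬ TransClosure SameTop c c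
  no-critical-cycle {c} b top≡t cycle with lowestPresent-spec b (top≡t⇒t∈ b top≡t)
  ... | x₀ , φ₀ , e₀ , x₀φ₀∈ , _ =
    no-cone-cycle x₀ (map⁺ to-cone (monotone-constant-on-cycle level (λ (s , top≡) → proj₁ (critical-step s top≡))
                                     (map-fixed-top _,_ cycle top≡t)))
    where
    to-cone : ∀ {u v} → (SameTop u v × top u ≡ t) × level v ≡ level c → ConeTraj x₀ u v
    to-cone ((s , top≡) , lv) with critical-step s top≡
    ... | _ , x , φ , e , cone
      with suffixes-length-injective t (subst (_∈ suffixes t) e (lowestPresent-suffix bv (top≡t⇒t∈ bv (trans (sym (proj₂ s)) top≡))))
             x₀φ₀∈ (trans (cong length (sym e)) (trans lv (cong length e₀)))
      where bv = step-target-Bd (proj₁ s)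
    ...   | refl = cone

  no-same-top-cycle : ∀ {c} → ¬ TransClosure SameTop c c
  no-same-top-cycle [ ((_ , _ , c≢c , _) , _) ]⁺ = c≢c refl
  no-same-top-cycle cycle@((step@(b , _ , _ , a , P@(ba , rule) , a⊆c , _) , same) ∷ _) with rule
  ... | inj₁ lt = lift-same-top step same P a⊆c lt
  ... | inj₂ (inj₁ pc@(α , β , p , α≢[] , top≡β , _ , x , x∉ , ins , _)) =
    no-cone-cycle x (map-fixed-top (pair-cone-traj p α≢[] x∉ ins) cycle
                      (trans same (trans (proj₂ (proj₂ (pair-cone-facts ba pc))) top≡β)))
  ... | inj₂ (inj₂ cc@(top≡t , _)) =
    no-critical-cycle b (trans same (trans (proj₂ (proj₂ (critical-cone-facts ba cc))) top≡t)) cycle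

  BdW-isGradient : IsGradient (_<ₗ_ _≺_) BdW
  BdW-isGradient c cycle with split-by-image top top-step (with-Bd cycle (target-Bd cycle))
    where
    target-Bd : ∀ {x y} → TransClosure (TrajStep (_<ₗ_ _≺_) BdW) x y → BdS y
    target-Bd [ (_ , _ , _ , P , _) ]⁺ = proj₁ (proj₂ (BdW-facet P))
    target-Bd (_ ∷ ss) = target-Bd ss
    with-Bd : ∀ {x y} → TransClosure (TrajStep (_<ₗ_ _≺_) BdW) x y → BdS x → TransClosure Step x y
    with-Bd [ s ]⁺ b = [ b , s ]⁺
    with-Bd (s@(_ , _ , _ , P , _) ∷ ss) b = (b , s) ∷ with-Bd ss (proj₁ (proj₂ (BdW-facet P)))
  ... | inj₁ hasse-cycle = Hasse-acyclic hasse-cycle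
  ... | inj₂ same-top-cycle = no-same-top-cycle same-top-cycle

proposition4p4 : {V : Set} (_<_ : Rel V 0ℓ) → IsStrictTotalOrder _≡_ _<_ →
                 (d : ℕ) (S : List V → Set) →
                 IsCombinatorialSphere _<_ d S →
                 IsCombinatorialSphere (_<ₗ_ _<_) d (Bd _<_ S)
proposition4p4 _<_ sto d S sphere = record
  { pseudomanifold = Bd-isPseudomanifold
  ; field′ = BdW
  ; isDVF = BdW-isDVF
  ; gradient = BdW-isGradient
  ; topCritical = topFlag
  ; vertCritical = [ vertCritical ]
  ; topIsCritical = topFlag-critical , proj₂ (suffixFlag-full S-t (proj₂ topIsCritical))
  ; vertIsCritical = vertexFlag-critical (proj₁ vertIsCritical) (distinct ∘ sym) , refl
  ; distinct = λ topFlag≡[w] → distinct (singleton⁻ (subst (topCritical ∈_) topFlag≡[w] t∈topFlag))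
  ; onlyThese = critical-flags (proj₂ vertIsCritical) onlyThese
  }
  where
  open IsCombinatorialSphere sphere
  open IsPseudomanifold pseudomanifold using (complex)
  open BdPseudomanifold sto pseudomanifold using (Bd-isPseudomanifold; suffixFlag-full)
  open BdField sto complex isDVF (proj₁ topIsCritical)
  open BdGradient sto complex isDVF (proj₁ topIsCritical) gradient using (BdW-isGradient)
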